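{- Consider the synchronous singing protocol on a static network in which every agent starts in state $\textsc{Un}$. For a round $i$, let $e_i$ denote the number of active edges in round $i$. Then for any round $i$, $$\mathbb{E}[e_{i+2}] \le \tfrac{3}{4}\, e_i ,$$ where the expectation is over the random $\ell$-values chosen in rounds $i$ and later (conditioned on the state of the protocol in round $i$).
   Context: Agents are the vertices of an undirected communication graph; two agents are neighbors if joined by an edge. Agents know nothing about the graph. Each agent is in one of three states $\{\textsc{Out},\textsc{In},\textsc{Un}\}$ and operates in rounds. Synchronous rounds: all agents' rounds start and end simultaneously, and every note sung by an agent during a round is heard by all its neighbors by the end of the round. In each round an agent hears the union of the notes (elements of $\{0,1,2,\dots\}$) sung by its neighbors; it can detect whether a given note is sung by at least one neighbor, but not by how many. Singing protocol (one round for an agent in state $s$): at the start of the round the agent computes a fresh $\ell$-value by flipping an unbiased coin until the first $0$ and letting $\ell$ be the number of flips (so $\Pr[\ell=k]=2^{ -k}$ for $k\ge1$), independently of everything else. If $s=\textsc{Out}$ it sings nothing; if $s=\textsc{In}$ it sings note $0$; if $s=\textsc{Un}$ it sings notes $1,\dots,\ell$. Every agent listens for note $0$; a $\textsc{Un}$ agent also listens for note $\ell$. At the end of the round: an $\textsc{In}$ agent becomes $\textsc{Un}$ if it heard note $0$, else stays $\textsc{In}$; a $\textsc{Un}$ agent becomes $\textsc{Out}$ if it heard note $0$, otherwise stays $\textsc{Un}$ if it heard note $\ell$ and becomes $\textsc{In}$ if it did not; an $\textsc{Out}$ agent stays $\textsc{Out}$ if it heard note $0$, else becomes $\textsc{Un}$.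 An agent is $\textsc{In}^{\overline{\textsc{In}}}$ in a round if it is in state $\textsc{In}$ and has no neighbor in state $\textsc{In}$ in that round. An agent is eliminated in round $i$ if it is $\textsc{In}^{\overline{\textsc{In}}}$ or is adjacent to an agent that is $\textsc{In}^{\overline{\textsc{In}}}$ in round $i$; otherwise it is active. An edge is eliminated if at least one endpoint is eliminated, otherwise it is active. -}

module Defs where

open import Data.Nat using (ℕ; zero; suc; _+_; _*_; _∸_; _^_; _≤_; _<ᵇ_; _≤ᵇ_)
open import Data.Bool using (Bool; true; false; if_then_else_; _∧_; _∨_; not)
open import Data.Fin using (Fin; toℕ) renaming (zero to fz; suc to fs)
open import Data.List using (List; map; upTo; length; filter; allFin)
open import Data.Bool.ListAction using (any)
open import Data.Nat.ListAction using (sum)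
open import Data.Bool.Properties using (T?)
open import Relation.Binary.PropositionalEquality using (_≡_)

record Graph (n : ℕ) : Set where
  field
    adj     : Fin n → Fin n → Bool
    adj-sym : ∀ u v → adj u v ≡ adj v u
    irrefl  : ∀ v → adj v v ≡ false
open Graph public

data St : Set where
  Out In Un : St

isIn : St → Bool
isIn In = true
isIn _  = false

isUn : St → Bool
isUn Un = true
isUn _  = false

Config : ℕ → Set
Config n = Fin n → St

-- ℓ-values of all agents in a round (each ℓ ≥ 1)
LVals : ℕ → Set
LVals n = Fin n → ℕ

anyFin : (n : ℕ) → (Fin n → Bool) → Bool
anyFin n p = any p (allFin n)

-- v hears note 0: some neighbor is In (and sings 0)
hears0 : ∀ {n} → Graph n → Config n → Fin n → Bool
hears0 {n} G c v = anyFin n (λ u → adj G v u ∧ isIn (c u))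

-- v hears note k (k ≥ 1): some Un neighbor u sings notes 1..ℓ u with k ≤ ℓ u
hearsNote : ∀ {n} → Graph n → Config n → LVals n → Fin n → ℕ → Bool
hearsNote {n} G c ℓ v k = anyFin n (λ u → adj G v u ∧ isUn (c u) ∧ (k ≤ᵇ ℓ u))

stepAgent : ∀ {n} → Graph n → Config n → LVals n → Fin n → St
stepAgent G c ℓ v with c v
... | In  = if hears0 G c v then Un else In
... | Un  = if hears0 G c v then Out
            else (if hearsNote G c ℓ v (ℓ v) then Un else In)
... | Out = if hears0 G c v then Out else Un

step : ∀ {n} → Graph n → Config n → LVals n → Config n
step G c ℓ = stepAgent G c ℓ

data Reachable {n : ℕ} (G : Graph n) : Config n → Set where
  start : Reachable G (λ _ → Un)
  next  : ∀ {c} → Reachable G c → (ℓ : LVals n) → (∀ v → 1 ≤ ℓ v) →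
          Reachable G (step G c ℓ)

inBar : ∀ {n} → Graph n → Config n → Fin n → Bool
inBar G c v = isIn (c v) ∧ not (hears0 G c v)

eliminated : ∀ {n} → Graph n → Config n → Fin n → Bool
eliminated {n} G c v = inBar G c v ∨ anyFin n (λ u → adj G v u ∧ inBar G c u)

active : ∀ {n} → Graph n → Config n → Fin n → Bool
active G c v = not (eliminated G c v)

activeEdges : ∀ {n} → Graph n → Config n → ℕ
activeEdges {n} G c =
  sum (map (λ u → length (filter (λ v → T? ((toℕ u <ᵇ toℕ v) ∧ adj G u v
                                              ∧ active G c u ∧ active G c v))
                                 (allFin n)))
           (allFin n))

cons : ∀ {n} → ℕ → LVals n → LVals (suc n)
cons k g fz     = k
cons k g (fs i) = g i

-- Scaled truncated expectation over i.i.d. ℓ-values with Pr[ℓ = k] = 2^{-k}: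
--   wsum n L f = Σ_{ℓ ∈ {1..L}^n} (Π_v 2^{L - ℓ_v}) · f ℓ
--              = 2^{nL} · Σ_{ℓ ∈ {1..L}^n} Pr[ℓ] · f ℓ .
wsum : (n : ℕ) → ℕ → (LVals n → ℕ) → ℕ
wsum zero    L f = f (λ ())
wsum (suc n) L f =
  sum (map (λ j → 2 ^ (L ∸ suc j) * wsum n L (λ g → f (cons (suc j) g))) (upTo L))

-- Fix the ℓ-values of the first of the two rounds; the bound holds for each of them. No two adjacent agents
-- are ever both In, so an agent is eliminated exactly when it is In or hears note 0, and agents that are active
-- after the first round are Un. Let xy be such an active edge and S the set of Un agents adjacent to x or y. If
-- ℓ x is strictly larger than the other ℓ-values on S, then x joins In and eliminates every edge at y, and these
-- events are disjoint for the different neighbours x of y. A trapezoid-rule estimate for the geometric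
-- distribution bounds the probability of this event below by about 2 / (3 |S|). Weighting these events by
-- degrees, the expected number of surviving edges is at most 3/4 of the active edges after the first round plus
-- a quarter of those at heavy endpoints (endpoints with many covered Un neighbours). The latter are paid for by
-- the edges at covered Un agents, which were active before the first round but not after it.
module Submission where

open import Defs
open import Data.Bool using (Bool; true; false; T; if_then_else_; _∧_; _∨_; not)
open import Data.Bool.ListAction using (or)
open import Data.Bool.Properties using (∧-zeroʳ; ∧-identityʳ; ∧-comm; ∨-comm; T-∧; T-∨; T-≡; T?)
open import Data.Empty using (⊥-elim)
open import Data.Fin using (Fin; toℕ) renaming (zero to fz; suc to fs)
open import Data.Fin.Properties using (_≟_; toℕ-injective) renaming (suc-injective to fs-injective)
open import Data.List using ([]; _∷_; map; upTo; applyUpTo; allFin; tabulate; filter; length)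
open import Data.List.Membership.Propositional using (lose)
open import Data.List.Membership.Propositional.Properties using (∈-allFin)
open import Data.List.Properties using (map-applyUpTo; map-tabulate; map-cong)
open import Data.List.Relation.Unary.Any using (satisfied)
open import Data.List.Relation.Unary.Any.Properties using (any⁺; any⁻)
open import Data.Nat
  using (ℕ; zero; suc; _+_; _*_; _∸_; _^_; _≤_; _<_; _<ᵇ_; _≡ᵇ_; z≤n; s≤s; z<s; >-nonZero; >-nonZero⁻¹)
open import Data.Nat.ListAction using () renaming (sum to sumList)
open import Data.Nat.Properties hiding (_≟_)
open import Data.Nat.Tactic.RingSolver using (solve-∀)
open import Algebra.Properties.Monoid.Sum *-1-monoid using () renaming (sum to ∏; sum-cong-≗ to ∏-cong-≗)
open import Algebra.Properties.Semiring.Sum +-*-semiring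
  using (sum; sum-syntax; sum-cong-≗; ∑-distrib-+; ∑-comm; *-distribˡ-sum; *-distribʳ-sum; sum-replicate-zero)
open import Data.Product using (∃; _×_; _,_; proj₁; proj₂)
open import Data.Sum using (inj₁; inj₂)
open import Function using (_∘_; const)
open import Function.Bundles using (module Equivalence)
open import Relation.Binary.Definitions using (tri<; tri≈; tri>)
open import Relation.Binary.PropositionalEquality
open import Relation.Nullary using (¬_; contradiction; yes; no)
open import Relation.Nullary.Decidable using (does; dec-true; dec-false)

open Equivalence using (to; from)
open ≤-Reasoning

T⇒≡true : ∀ {b} → T b → b ≡ true
T⇒≡true = to T-≡

¬T⇒≡false : ∀ {b} → ¬ T b → b ≡ false
¬T⇒≡false {true}  ¬b = contradiction _ ¬b
¬T⇒≡false {false} ¬b = refl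

¬T⇒T-not : ∀ {b} → ¬ T b → T (not b)
¬T⇒T-not {true}  ¬b = ¬b _
¬T⇒T-not {false} ¬b = _

T-not⇒¬T : ∀ {b} → T (not b) → ¬ T b
T-not⇒¬T {true} ()

T-∨ˡ : ∀ {a} b → T a → T (a ∨ b)
T-∨ˡ b ta = from T-∨ (inj₁ ta)

T-∨ʳ : ∀ a {b} → T b → T (a ∨ b)
T-∨ʳ a tb = from T-∨ (inj₂ tb)

𝟙 : Bool → ℕ
𝟙 true  = 1
𝟙 false = 0

𝟙≤1 : ∀ b → 𝟙 b ≤ 1
𝟙≤1 true  = ≤-refl
𝟙≤1 false = z≤n

𝟙-positive : ∀ {b} → 0 < 𝟙 b → T b
𝟙-positive {true} _ = _

𝟙-false : ∀ {a} → ¬ T a → 𝟙 a ≡ 0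
𝟙-false ¬a = cong 𝟙 (¬T⇒≡false ¬a)

𝟙-mono : ∀ {a b} → (T a → T b) → 𝟙 a ≤ 𝟙 b
𝟙-mono {true}  a⇒b = ≤-reflexive (sym (cong 𝟙 (T⇒≡true (a⇒b _))))
𝟙-mono {false} a⇒b = z≤n

𝟙-∨ : ∀ a b → 𝟙 (a ∨ b) ≤ 𝟙 a + 𝟙 b
𝟙-∨ true  b = s≤s z≤n
𝟙-∨ false b = ≤-refl

𝟙-*-mono-≤ : ∀ b {m k} → (T b → m ≤ k) → 𝟙 b * m ≤ 𝟙 b * k
𝟙-*-mono-≤ true  m≤k = *-monoʳ-≤ 1 (m≤k _)
𝟙-*-mono-≤ false _   = z≤n

𝟙-exclusive : ∀ {a b c d} → (T a → T d) → (T b → T d) → (T c → T d) →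
              (T a → ¬ T b) → (T a → ¬ T c) → (T b → ¬ T c) → 𝟙 a + 𝟙 b + 𝟙 c ≤ 𝟙 d
𝟙-exclusive {true}  {true}          _ _ _ ab _  _  = contradiction _ (ab _)
𝟙-exclusive {true}  {false} {true}  _ _ _ _  ac _  = contradiction _ (ac _)
𝟙-exclusive {true}  {false} {false} ad _ _ _ _ _   = 𝟙-mono ad
𝟙-exclusive {false} {true}  {true}  _ _ _ _  _  bc = contradiction _ (bc _)
𝟙-exclusive {false} {true}  {false} _ bd _ _ _ _   = 𝟙-mono bd
𝟙-exclusive {false} {false} {c}     _ _ cd _ _ _   = 𝟙-mono cd

*-positiveˡ : ∀ m {n} → 0 < m * n → 0 < m
*-positiveˡ m pos = >-nonZero⁻¹ m {{m*n≢0⇒m≢0 m {{>-nonZero pos}}}}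

*-positiveʳ : ∀ m {n} → 0 < m * n → 0 < n
*-positiveʳ m pos = >-nonZero⁻¹ _ {{m*n≢0⇒n≢0 m {{>-nonZero pos}}}}

count : ∀ {n} → (Fin n → Bool) → ℕ
count p = sum (𝟙 ∘ p)

sum-mono-≤ : ∀ {n} {f g : Fin n → ℕ} → (∀ i → f i ≤ g i) → sum f ≤ sum g
sum-mono-≤ {zero}  f≤g = z≤n
sum-mono-≤ {suc n} f≤g = +-mono-≤ (f≤g fz) (sum-mono-≤ (f≤g ∘ fs))

sum-zero : ∀ {n} {f : Fin n → ℕ} → (∀ i → f i ≡ 0) → sum f ≡ 0
sum-zero {n} f≡0 = trans (sum-cong-≗ f≡0) (sum-replicate-zero n)

sum-*ˡ : ∀ {n} c (f : Fin n → ℕ) → ∑[ i < n ] (c * f i) ≡ c * sum f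
sum-*ˡ c f = sym (*-distribˡ-sum c f)

sum-positive : ∀ {n} (f : Fin n → ℕ) → 0 < sum f → ∃ λ i → 0 < f i
sum-positive {suc n} f pos with f fz in eq
... | suc _ = fz , subst (0 <_) (sym eq) (s≤s z≤n)
... | zero with sum-positive (f ∘ fs) pos
...   | i , fi>0 = fs i , fi>0

sum-≤1 : ∀ {n} (f : Fin n → ℕ) → (∀ i → f i ≤ 1) →
         (∀ i j → 0 < f i → 0 < f j → i ≡ j) → sum f ≤ 1
sum-≤1 {zero}  f f≤1 unique = z≤n
sum-≤1 {suc n} f f≤1 unique with f fz in eq
... | zero  = sum-≤1 (f ∘ fs) (f≤1 ∘ fs) λ i j p q → fs-injective (unique (fs i) (fs j) p q)
... | suc k = begin
  suc k + sum (f ∘ fs) ≡⟨ cong (suc k +_) (sum-zero rest≡0) ⟩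
  suc k + 0            ≡⟨ +-identityʳ (suc k) ⟩
  suc k                ≡⟨ eq ⟨
  f fz                 ≤⟨ f≤1 fz ⟩
  1                    ∎
  where
  rest≡0 : ∀ i → f (fs i) ≡ 0
  rest≡0 i with f (fs i) in eqᵢ
  ... | zero  = refl
  ... | suc _ with () ← unique fz (fs i) (subst (0 <_) (sym eq) (s≤s z≤n)) (subst (0 <_) (sym eqᵢ) (s≤s z≤n))

∑∑ : ∀ {n} → (Fin n → Fin n → ℕ) → ℕ
∑∑ {n} f = ∑[ y < n ] ∑[ x < n ] f x y

module _ {n : ℕ} where

  ∑∑-cong : ∀ {f g : Fin n → Fin n → ℕ} → (∀ x y → f x y ≡ g x y) → ∑∑ f ≡ ∑∑ g
  ∑∑-cong f≗g = sum-cong-≗ (λ y → sum-cong-≗ (λ x → f≗g x y))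

  ∑∑-mono-≤ : ∀ {f g : Fin n → Fin n → ℕ} → (∀ x y → f x y ≤ g x y) → ∑∑ f ≤ ∑∑ g
  ∑∑-mono-≤ f≤g = sum-mono-≤ (λ y → sum-mono-≤ (λ x → f≤g x y))

  ∑∑-+ : ∀ (f g : Fin n → Fin n → ℕ) → ∑∑ (λ x y → f x y + g x y) ≡ ∑∑ f + ∑∑ g
  ∑∑-+ f g = trans (sum-cong-≗ (λ y → ∑-distrib-+ (λ x → f x y) (λ x → g x y)))
                   (∑-distrib-+ (λ y → ∑[ x < n ] f x y) (λ y → ∑[ x < n ] g x y))

  ∑∑-*ˡ : ∀ c (f : Fin n → Fin n → ℕ) → ∑∑ (λ x y → c * f x y) ≡ c * ∑∑ f
  ∑∑-*ˡ c f = trans (sum-cong-≗ (λ y → sum-*ˡ c (λ x → f x y))) (sum-*ˡ c (λ y → ∑[ x < n ] f x y))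

  ∑∑-transpose : ∀ (f : Fin n → Fin n → ℕ) → ∑∑ f ≡ ∑∑ (λ x y → f y x)
  ∑∑-transpose f = ∑-comm (λ y x → f x y)

∏-≤1 : ∀ {n} (f : Fin n → ℕ) → (∀ v → f v ≤ 1) → ∏ f ≤ 1
∏-≤1 {zero}  f f≤1 = ≤-refl
∏-≤1 {suc n} f f≤1 = *-mono-≤ (f≤1 fz) (∏-≤1 (f ∘ fs) (f≤1 ∘ fs))

∏-positive : ∀ {n} (f : Fin n → ℕ) → 0 < ∏ f → ∀ v → 0 < f v
∏-positive {suc n} f pos fz     = *-positiveˡ (f fz) pos
∏-positive {suc n} f pos (fs v) = ∏-positive (f ∘ fs) (*-positiveʳ (f fz) pos) v

∏-twoValued : ∀ {n} (S : Fin n → Bool) β γ →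
              ∏ (λ v → if S v then β else γ) ≡ β ^ count S * γ ^ count (not ∘ S)
∏-twoValued {zero}  S β γ = refl
∏-twoValued {suc n} S β γ with S fz
... | true  rewrite ∏-twoValued (S ∘ fs) β γ = sym (*-assoc β _ _)
... | false rewrite ∏-twoValued (S ∘ fs) β γ = solve β γ (β ^ count (S ∘ fs)) (γ ^ count (not ∘ S ∘ fs))
  where
  solve : ∀ β γ a b → γ * (a * b) ≡ a * (γ * b)
  solve = solve-∀

without : ∀ {n} → (Fin n → Bool) → Fin n → Fin n → Bool
without S x v = S v ∧ not (does (v ≟ x))

count-without : ∀ {n} (S : Fin n → Bool) x → T (S x) → suc (count (without S x)) ≡ count S
count-without {suc n} S fz     Sx with true ← S fz = cong suc (sum-cong-≗ (λ v → cong 𝟙 (∧-identityʳ (S (fs v)))))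
count-without {suc n} S (fs x) Sx = trans (sym (+-suc (𝟙 (S fz ∧ true)) _))
                                  (cong₂ _+_ (cong 𝟙 (∧-identityʳ (S fz))) (count-without (S ∘ fs) x Sx))

count-complement : ∀ {n} (S : Fin n → Bool) → count S + count (not ∘ S) ≡ n
count-complement {zero}  S = refl
count-complement {suc n} S with S fz
... | true  = cong suc (count-complement (S ∘ fs))
... | false = trans (+-suc (count (S ∘ fs)) _) (cong suc (count-complement (S ∘ fs)))

∏-threeValued : ∀ {n} (S : Fin n → Bool) x → T (S x) → ∀ α β γ →
                ∏ (λ v → if does (v ≟ x) then α else if S v then β else γ)
                  ≡ α * β ^ count (without S x) * γ ^ count (not ∘ S)
∏-threeValued S fz     Sx α β γ with true ← S fz
  rewrite ∏-twoValued (S ∘ fs) β γ | sum-cong-≗ (λ v → cong 𝟙 (∧-identityʳ (S (fs v)))) = sym (*-assoc α _ _)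
∏-threeValued S (fs x) Sx α β γ with S fz | ∏-threeValued (S ∘ fs) x Sx α β γ
... | true  | ih rewrite ih = solve α β (β ^ count (without (S ∘ fs) x)) (γ ^ count (not ∘ S ∘ fs))
  where
  solve : ∀ α β a b → β * (α * a * b) ≡ α * (β * a) * b
  solve = solve-∀
... | false | ih rewrite ih = solve α γ (β ^ count (without (S ∘ fs) x)) (γ ^ count (not ∘ S ∘ fs))
  where
  solve : ∀ α γ a b → γ * (α * a * b) ≡ α * a * (γ * b)
  solve = solve-∀


-- The truncated geometric distribution

-- 𝔼₁ L φ = Σ_{k=1}^{L} 2^(L-k) φ k is 2^L times the expectation of φ (ℓ) for a single ℓ-value,
-- truncated to ℓ ≤ L; wsum n L is its n-fold product (wsum-suc).
𝔼₁ : ℕ → (ℕ → ℕ) → ℕ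
𝔼₁ zero    φ = 0
𝔼₁ (suc L) φ = 2 ^ L * φ 1 + 𝔼₁ L (φ ∘ suc)

total : ℕ → ℕ
total L = 𝔼₁ L (const 1)

suc-total : ∀ L → suc (total L) ≡ 2 ^ L
suc-total zero    = refl
suc-total (suc L) = begin-equality
  suc (2 ^ L * 1 + total L) ≡⟨ +-suc (2 ^ L * 1) (total L) ⟨
  2 ^ L * 1 + suc (total L) ≡⟨ cong₂ _+_ (*-identityʳ (2 ^ L)) (suc-total L) ⟩
  2 ^ L + 2 ^ L             ≡⟨ cong (2 ^ L +_) (+-identityʳ (2 ^ L)) ⟨
  2 * 2 ^ L                 ∎

total≤2^ : ∀ L → total L ≤ 2 ^ L
total≤2^ L = ≤-trans (n≤1+n (total L)) (≤-reflexive (suc-total L))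

𝔼₁-cong : ∀ L {φ ψ : ℕ → ℕ} → (∀ k → φ k ≡ ψ k) → 𝔼₁ L φ ≡ 𝔼₁ L ψ
𝔼₁-cong zero    φ≗ψ = refl
𝔼₁-cong (suc L) φ≗ψ = cong₂ _+_ (cong (2 ^ L *_) (φ≗ψ 1)) (𝔼₁-cong L (φ≗ψ ∘ suc))

𝔼₁-mono-≤ : ∀ L {φ ψ : ℕ → ℕ} → (∀ k → φ k ≤ ψ k) → 𝔼₁ L φ ≤ 𝔼₁ L ψ
𝔼₁-mono-≤ zero    φ≤ψ = z≤n
𝔼₁-mono-≤ (suc L) φ≤ψ = +-mono-≤ (*-monoʳ-≤ (2 ^ L) (φ≤ψ 1)) (𝔼₁-mono-≤ L (φ≤ψ ∘ suc))

𝔼₁-+ : ∀ L (φ ψ : ℕ → ℕ) → 𝔼₁ L (λ k → φ k + ψ k) ≡ 𝔼₁ L φ + 𝔼₁ L ψ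
𝔼₁-+ zero    φ ψ = refl
𝔼₁-+ (suc L) φ ψ rewrite 𝔼₁-+ L (φ ∘ suc) (ψ ∘ suc) =
  solve (2 ^ L) (φ 1) (ψ 1) (𝔼₁ L (φ ∘ suc)) (𝔼₁ L (ψ ∘ suc))
  where
  solve : ∀ w a b A B → w * (a + b) + (A + B) ≡ w * a + A + (w * b + B)
  solve = solve-∀

𝔼₁-*ˡ : ∀ L c (φ : ℕ → ℕ) → 𝔼₁ L (λ k → c * φ k) ≡ c * 𝔼₁ L φ
𝔼₁-*ˡ zero    c φ = sym (*-zeroʳ c)
𝔼₁-*ˡ (suc L) c φ rewrite 𝔼₁-*ˡ L c (φ ∘ suc) = solve (2 ^ L) c (φ 1) (𝔼₁ L (φ ∘ suc))
  where
  solve : ∀ w c a A → w * (c * a) + c * A ≡ c * (w * a + A)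
  solve = solve-∀

𝔼₁-*ʳ : ∀ L c (φ : ℕ → ℕ) → 𝔼₁ L (λ k → φ k * c) ≡ 𝔼₁ L φ * c
𝔼₁-*ʳ L c φ = begin-equality
  𝔼₁ L (λ k → φ k * c) ≡⟨ 𝔼₁-cong L (λ k → *-comm (φ k) c) ⟩
  𝔼₁ L (λ k → c * φ k) ≡⟨ 𝔼₁-*ˡ L c φ ⟩
  c * 𝔼₁ L φ           ≡⟨ *-comm c (𝔼₁ L φ) ⟩
  𝔼₁ L φ * c           ∎

𝔼₁-const : ∀ L c → 𝔼₁ L (const c) ≡ c * total L
𝔼₁-const L c = trans (𝔼₁-cong L (λ _ → sym (*-identityʳ c))) (𝔼₁-*ˡ L c (const 1))

𝔼₁-vanishing : ∀ L {φ : ℕ → ℕ} → (∀ k → φ (suc k) ≡ 0) → 𝔼₁ L φ ≡ 0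
𝔼₁-vanishing zero    φ≡0 = refl
𝔼₁-vanishing (suc L) φ≡0 =
  cong₂ _+_ (trans (cong (2 ^ L *_) (φ≡0 0)) (*-zeroʳ (2 ^ L))) (𝔼₁-vanishing L (φ≡0 ∘ suc))


sumList-upTo≡𝔼₁ : ∀ L (φ : ℕ → ℕ) →
                  sumList (map (λ j → 2 ^ (L ∸ suc j) * φ (suc j)) (upTo L)) ≡ 𝔼₁ L φ
sumList-upTo≡𝔼₁ zero    φ = refl
sumList-upTo≡𝔼₁ (suc L) φ = cong (2 ^ L * φ 1 +_) (begin-equality
  sumList (map g (applyUpTo suc L))    ≡⟨ cong sumList (map-applyUpTo suc g L) ⟩
  sumList (applyUpTo (g ∘ suc) L)      ≡⟨ cong sumList (map-applyUpTo (λ j → j) (g ∘ suc) L) ⟨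
  sumList (map (g ∘ suc) (upTo L))     ≡⟨ sumList-upTo≡𝔼₁ L (φ ∘ suc) ⟩
  𝔼₁ L (φ ∘ suc)                       ∎)
  where
  g : ℕ → ℕ
  g j = 2 ^ (suc L ∸ suc j) * φ (suc j)

wsum-suc : ∀ n L (f : LVals (suc n) → ℕ) → wsum (suc n) L f ≡ 𝔼₁ L (λ k → wsum n L (f ∘ cons k))
wsum-suc n L f = sumList-upTo≡𝔼₁ L (λ k → wsum n L (f ∘ cons k))

wsum-cong : ∀ n L {f g : LVals n → ℕ} → (∀ ℓ → f ℓ ≡ g ℓ) → wsum n L f ≡ wsum n L g
wsum-cong zero    L f≗g = f≗g _
wsum-cong (suc n) L {f} {g} f≗g = begin-equality
  wsum (suc n) L f                        ≡⟨ wsum-suc n L f ⟩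
  𝔼₁ L (λ k → wsum n L (f ∘ cons k))      ≡⟨ 𝔼₁-cong L (λ k → wsum-cong n L (f≗g ∘ cons k)) ⟩
  𝔼₁ L (λ k → wsum n L (g ∘ cons k))      ≡⟨ wsum-suc n L g ⟨
  wsum (suc n) L g                        ∎

wsum-mono-≤ : ∀ n L {f g : LVals n → ℕ} → (∀ ℓ → f ℓ ≤ g ℓ) → wsum n L f ≤ wsum n L g
wsum-mono-≤ zero    L f≤g = f≤g _
wsum-mono-≤ (suc n) L {f} {g} f≤g = begin
  wsum (suc n) L f                        ≡⟨ wsum-suc n L f ⟩
  𝔼₁ L (λ k → wsum n L (f ∘ cons k))      ≤⟨ 𝔼₁-mono-≤ L (λ k → wsum-mono-≤ n L (f≤g ∘ cons k)) ⟩
  𝔼₁ L (λ k → wsum n L (g ∘ cons k))      ≡⟨ wsum-suc n L g ⟨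
  wsum (suc n) L g                        ∎

wsum-+ : ∀ n L (f g : LVals n → ℕ) → wsum n L (λ ℓ → f ℓ + g ℓ) ≡ wsum n L f + wsum n L g
wsum-+ zero    L f g = refl
wsum-+ (suc n) L f g = begin-equality
  wsum (suc n) L (λ ℓ → f ℓ + g ℓ)
    ≡⟨ wsum-suc n L (λ ℓ → f ℓ + g ℓ) ⟩
  𝔼₁ L (λ k → wsum n L (λ ℓ → f (cons k ℓ) + g (cons k ℓ)))
    ≡⟨ 𝔼₁-cong L (λ k → wsum-+ n L (f ∘ cons k) (g ∘ cons k)) ⟩
  𝔼₁ L (λ k → wsum n L (f ∘ cons k) + wsum n L (g ∘ cons k))
    ≡⟨ 𝔼₁-+ L (λ k → wsum n L (f ∘ cons k)) (λ k → wsum n L (g ∘ cons k)) ⟩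
  𝔼₁ L (λ k → wsum n L (f ∘ cons k)) + 𝔼₁ L (λ k → wsum n L (g ∘ cons k))
    ≡⟨ cong₂ _+_ (wsum-suc n L f) (wsum-suc n L g) ⟨
  wsum (suc n) L f + wsum (suc n) L g
    ∎

wsum-*ˡ : ∀ n L c (f : LVals n → ℕ) → wsum n L (λ ℓ → c * f ℓ) ≡ c * wsum n L f
wsum-*ˡ zero    L c f = refl
wsum-*ˡ (suc n) L c f = begin-equality
  wsum (suc n) L (λ ℓ → c * f ℓ)            ≡⟨ wsum-suc n L (λ ℓ → c * f ℓ) ⟩
  𝔼₁ L (λ k → wsum n L (λ ℓ → c * f (cons k ℓ))) ≡⟨ 𝔼₁-cong L (λ k → wsum-*ˡ n L c (f ∘ cons k)) ⟩
  𝔼₁ L (λ k → c * wsum n L (f ∘ cons k))    ≡⟨ 𝔼₁-*ˡ L c (λ k → wsum n L (f ∘ cons k)) ⟩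
  c * 𝔼₁ L (λ k → wsum n L (f ∘ cons k))    ≡⟨ cong (c *_) (wsum-suc n L f) ⟨
  c * wsum (suc n) L f                      ∎

wsum-const : ∀ n L c → wsum n L (const c) ≡ c * total L ^ n
wsum-const zero    L c = sym (*-identityʳ c)
wsum-const (suc n) L c = begin-equality
  wsum (suc n) L (const c)           ≡⟨ wsum-suc n L (const c) ⟩
  𝔼₁ L (λ _ → wsum n L (const c))    ≡⟨ 𝔼₁-const L (wsum n L (const c)) ⟩
  wsum n L (const c) * total L       ≡⟨ cong (_* total L) (wsum-const n L c) ⟩
  c * total L ^ n * total L          ≡⟨ solve c (total L) (total L ^ n) ⟩
  c * total L ^ suc n                ∎
  where
  solve : ∀ c t p → c * p * t ≡ c * (t * p)
  solve = solve-∀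

wsum-sum : ∀ n L {m} (f : Fin m → LVals n → ℕ) →
           wsum n L (λ ℓ → ∑[ i < m ] f i ℓ) ≡ ∑[ i < m ] wsum n L (f i)
wsum-sum n L {zero}  f = wsum-const n L 0
wsum-sum n L {suc m} f = begin-equality
  wsum n L (λ ℓ → f fz ℓ + ∑[ i < m ] f (fs i) ℓ)
    ≡⟨ wsum-+ n L (f fz) (λ ℓ → ∑[ i < m ] f (fs i) ℓ) ⟩
  wsum n L (f fz) + wsum n L (λ ℓ → ∑[ i < m ] f (fs i) ℓ)
    ≡⟨ cong (wsum n L (f fz) +_) (wsum-sum n L (f ∘ fs)) ⟩
  wsum n L (f fz) + ∑[ i < m ] wsum n L (f (fs i))
    ∎

wsum-∏ : ∀ n L (h : Fin n → ℕ → ℕ) →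
         wsum n L (λ ℓ → ∏ (λ v → h v (ℓ v))) ≡ ∏ (λ v → 𝔼₁ L (h v))
wsum-∏ zero    L h = refl
wsum-∏ (suc n) L h = begin-equality
  wsum (suc n) L (λ ℓ → ∏ (λ v → h v (ℓ v)))
    ≡⟨ wsum-suc n L (λ ℓ → ∏ (λ v → h v (ℓ v))) ⟩
  𝔼₁ L (λ k → wsum n L (λ ℓ → h fz k * ∏ (λ v → h (fs v) (ℓ v))))
    ≡⟨ 𝔼₁-cong L (λ k → wsum-*ˡ n L (h fz k) (λ ℓ → ∏ (λ v → h (fs v) (ℓ v)))) ⟩
  𝔼₁ L (λ k → h fz k * wsum n L (λ ℓ → ∏ (λ v → h (fs v) (ℓ v))))
    ≡⟨ 𝔼₁-*ʳ L _ (h fz) ⟩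
  𝔼₁ L (h fz) * wsum n L (λ ℓ → ∏ (λ v → h (fs v) (ℓ v)))
    ≡⟨ cong (𝔼₁ L (h fz) *_) (wsum-∏ n L (h ∘ fs)) ⟩
  𝔼₁ L (h fz) * ∏ (λ v → 𝔼₁ L (h (fs v)))
    ∎


-- A trapezoid estimate

bernoulli : ∀ Q x r → Q ^ suc r + suc r * x * Q ^ r ≤ (Q + x) ^ suc r
bernoulli Q x zero    = ≤-reflexive (solve Q x)
  where
  solve : ∀ Q x → Q * 1 + 1 * x * 1 ≡ (Q + x) * 1
  solve = solve-∀
bernoulli Q x (suc r) = begin
  Q ^ suc (suc r) + suc (suc r) * x * Q ^ suc r
    ≤⟨ m≤m+n _ (suc r * x * x * Q ^ r) ⟩
  Q ^ suc (suc r) + suc (suc r) * x * Q ^ suc r + suc r * x * x * Q ^ r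
    ≡⟨ solve Q x (Q ^ r) r ⟩
  (Q + x) * (Q ^ suc r + suc r * x * Q ^ r)
    ≤⟨ *-monoʳ-≤ (Q + x) (bernoulli Q x r) ⟩
  (Q + x) ^ suc (suc r)
    ∎
  where
  solve : ∀ Q x q r → Q * (Q * q) + suc (suc r) * x * (Q * q) + suc r * x * x * q ≡ (Q + x) * (Q * q + suc r * x * q)
  solve = solve-∀


-- The trapezoid rule overestimates the integral of the convex function (r+1) t^r.
trapezoid : ∀ Q x r → 2 * (Q + x) ^ suc r ≤ 2 * Q ^ suc r + suc r * x * (Q ^ r + (Q + x) ^ r)
trapezoid Q x zero    = ≤-reflexive (solve Q x)
  where
  solve : ∀ Q x → 2 * ((Q + x) * 1) ≡ 2 * (Q * 1) + 1 * x * (1 + 1)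
  solve = solve-∀
trapezoid Q x (suc r) = begin
  2 * (Q + x) ^ suc (suc r)
    ≡⟨ solve₀ (Q + x) ((Q + x) ^ suc r) ⟩
  (Q + x) * (2 * (Q + x) ^ suc r)
    ≤⟨ *-monoʳ-≤ (Q + x) (trapezoid Q x r) ⟩
  (Q + x) * (2 * Q ^ suc r + suc r * x * (Q ^ r + (Q + x) ^ r))
    ≡⟨ solve₁ Q x (Q ^ r) ((Q + x) ^ r) r ⟩
  2 * Q ^ suc (suc r) + suc (suc r) * x * Q ^ suc r + suc r * x * (Q + x) ^ suc r + x * (Q ^ suc r + suc r * x * Q ^ r)
    ≤⟨ +-monoʳ-≤ _ (*-monoʳ-≤ x (bernoulli Q x r)) ⟩
  2 * Q ^ suc (suc r) + suc (suc r) * x * Q ^ suc r + suc r * x * (Q + x) ^ suc r + x * (Q + x) ^ suc r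
    ≡⟨ solve₂ Q x (Q ^ suc r) ((Q + x) ^ suc r) r ⟩
  2 * Q ^ suc (suc r) + suc (suc r) * x * (Q ^ suc r + (Q + x) ^ suc r)
    ∎
  where
  solve₀ : ∀ y p → 2 * (y * p) ≡ y * (2 * p)
  solve₀ = solve-∀
  solve₁ : ∀ Q x q p r → (Q + x) * (2 * (Q * q) + suc r * x * (q + p))
                       ≡ 2 * (Q * (Q * q)) + suc (suc r) * x * (Q * q) + suc r * x * ((Q + x) * p) + x * (Q * q + suc r * x * q)
  solve₁ = solve-∀
  solve₂ : ∀ Q x q p r → 2 * (Q * q) + suc (suc r) * x * q + suc r * x * p + x * p
                       ≡ 2 * (Q * q) + suc (suc r) * x * (q + p)
  solve₂ = solve-∀


-- Left and right Riemann sums of t ↦ t^r over [Q, Q + total L], cut into cells of widths 2^(L-1), …, 2, 1.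
leftSum rightSum : ℕ → ℕ → ℕ → ℕ
leftSum  r zero    Q = 0
leftSum  r (suc L) Q = 2 ^ L * Q ^ r + leftSum r L (Q + 2 ^ L)
rightSum r zero    Q = 0
rightSum r (suc L) Q = 2 ^ L * (Q + 2 ^ L) ^ r + rightSum r L (Q + 2 ^ L)

+-total-suc : ∀ Q L → Q + total (suc L) ≡ Q + 2 ^ L + total L
+-total-suc Q L = trans (cong (λ x → Q + (x + total L)) (*-identityʳ (2 ^ L))) (sym (+-assoc Q (2 ^ L) (total L)))

trapezoid-sum : ∀ r L Q → 2 * (Q + total L) ^ suc r ≤ 2 * Q ^ suc r + suc r * (leftSum r L Q + rightSum r L Q)
trapezoid-sum r zero    Q = ≤-reflexive (trans (cong (λ y → 2 * y ^ suc r) (+-identityʳ Q)) (solve (Q ^ suc r) r))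
  where
  solve : ∀ q r → 2 * q ≡ 2 * q + suc r * (0 + 0)
  solve = solve-∀
trapezoid-sum r (suc L) Q = begin
  2 * (Q + total (suc L)) ^ suc r
    ≡⟨ cong (λ y → 2 * y ^ suc r) (+-total-suc Q L) ⟩
  2 * (Q′ + total L) ^ suc r
    ≤⟨ trapezoid-sum r L Q′ ⟩
  2 * Q′ ^ suc r + suc r * (leftSum r L Q′ + rightSum r L Q′)
    ≤⟨ +-monoˡ-≤ _ (trapezoid Q x r) ⟩
  2 * Q ^ suc r + suc r * x * (Q ^ r + Q′ ^ r) + suc r * (leftSum r L Q′ + rightSum r L Q′)
    ≡⟨ solve (Q ^ suc r) (Q ^ r) (Q′ ^ r) x r (leftSum r L Q′) (rightSum r L Q′) ⟩
  2 * Q ^ suc r + suc r * (leftSum r (suc L) Q + rightSum r (suc L) Q)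
    ∎
  where
  x  = 2 ^ L
  Q′ = Q + x
  solve : ∀ q₁ q p x r l l′ → 2 * q₁ + suc r * x * (q + p) + suc r * (l + l′)
                             ≡ 2 * q₁ + suc r * ((x * q + l) + (x * p + l′))
  solve = solve-∀

-- Each cell is twice as wide as the next, so its right-endpoint term is twice the next cell's left-endpoint term.
rightSum-bound : ∀ r L Q → rightSum r L Q + 2 ^ L * Q ^ r ≤ 2 * leftSum r L Q + (Q + total L) ^ r
rightSum-bound r zero    Q = ≤-reflexive (cong₂ _+_ refl (trans (*-identityˡ (Q ^ r)) (cong (_^ r) (sym (+-identityʳ Q)))))
rightSum-bound r (suc L) Q = begin
  rightSum r (suc L) Q + 2 ^ suc L * Q ^ r
    ≡⟨ solve x (Q ^ r) (Q′ ^ r) (rightSum r L Q′) ⟩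
  (rightSum r L Q′ + x * Q′ ^ r) + 2 * (x * Q ^ r)
    ≤⟨ +-monoˡ-≤ _ (rightSum-bound r L Q′) ⟩
  2 * leftSum r L Q′ + (Q′ + total L) ^ r + 2 * (x * Q ^ r)
    ≡⟨ solve′ (leftSum r L Q′) ((Q′ + total L) ^ r) (x * Q ^ r) ⟩
  2 * leftSum r (suc L) Q + (Q′ + total L) ^ r
    ≡⟨ cong (λ y → 2 * leftSum r (suc L) Q + y ^ r) (+-total-suc Q L) ⟨
  2 * leftSum r (suc L) Q + (Q + total (suc L)) ^ r
    ∎
  where
  x  = 2 ^ L
  Q′ = Q + x
  solve : ∀ x q p R → (x * p + R) + 2 * x * q ≡ (R + x * p) + 2 * (x * q)
  solve = solve-∀
  solve′ : ∀ l p y → 2 * l + p + 2 * y ≡ 2 * (y + l) + p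
  solve′ = solve-∀

riemann-estimate : ∀ r L → 2 * total L ^ suc r ≤ suc r * (3 * leftSum r L 0 + total L ^ r)
riemann-estimate r L = begin
  2 * total L ^ suc r                   ≤⟨ trapezoid-sum r L 0 ⟩
  suc r * (G + rightSum r L 0)          ≤⟨ *-monoʳ-≤ (suc r) (+-monoʳ-≤ G right≤) ⟩
  suc r * (G + (2 * G + total L ^ r))   ≡⟨ cong (suc r *_) (solve G (total L ^ r)) ⟩
  suc r * (3 * G + total L ^ r)         ∎
  where
  G = leftSum r L 0
  right≤ : rightSum r L 0 ≤ 2 * G + total L ^ r
  right≤ = ≤-trans (m≤m+n _ _) (rightSum-bound r L 0)
  solve : ∀ g t → g + (2 * g + t) ≡ 3 * g + t
  solve = solve-∀

-- leftSum r L 0 / 2^(L(r+1)) is the probability that one given agent out of r + 1 draws the strict maximum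
-- (levels≡leftSum); for a = 3 (r + 1) / 4 the estimate says that, up to truncation, it is at least 2 / (3 (r + 1)).
leftSum-estimate : ∀ r L a → 3 * suc r ≤ 4 * a → 4 * total L ^ suc r ≤ 2 * a * leftSum r L 0 + 3 * (2 ^ L) ^ suc r
leftSum-estimate r L a 3r≤4a = *-cancelˡ-≤ 2 (begin
  2 * (4 * t)                               ≡⟨ solve₁ t ⟩
  6 * t + 2 * t                             ≤⟨ +-monoʳ-≤ (6 * t) (riemann-estimate r L) ⟩
  6 * t + suc r * (3 * G + s)               ≡⟨ solve₂ t (suc r) G s ⟩
  6 * t + 3 * suc r * G + suc r * s         ≤⟨ +-mono-≤ (+-monoʳ-≤ (6 * t) (*-monoˡ-≤ G 3r≤4a))
                                                         (m≤n*m (suc r * s) 6) ⟩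
  6 * t + 4 * a * G + 6 * (suc r * s)       ≡⟨ solve₃ t (suc r) a G s ⟩
  6 * (t + suc r * 1 * s) + 4 * a * G       ≤⟨ +-monoˡ-≤ (4 * a * G) (*-monoʳ-≤ 6 (bernoulli (total L) 1 r)) ⟩
  6 * (total L + 1) ^ suc r + 4 * a * G     ≡⟨ cong (λ y → 6 * y ^ suc r + 4 * a * G)
                                                    (trans (+-comm (total L) 1) (suc-total L)) ⟩
  6 * (2 ^ L) ^ suc r + 4 * a * G           ≡⟨ solve₄ ((2 ^ L) ^ suc r) a G ⟩
  2 * (2 * a * G + 3 * (2 ^ L) ^ suc r)     ∎)
  where
  t = total L ^ suc r
  s = total L ^ r
  G = leftSum r L 0
  solve₁ : ∀ t → 2 * (4 * t) ≡ 6 * t + 2 * t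
  solve₁ = solve-∀
  solve₂ : ∀ t ρ g s → 6 * t + ρ * (3 * g + s) ≡ 6 * t + 3 * ρ * g + ρ * s
  solve₂ = solve-∀
  solve₃ : ∀ t ρ a g s → 6 * t + 4 * a * g + 6 * (ρ * s) ≡ 6 * (t + ρ * 1 * s) + 4 * a * g
  solve₃ = solve-∀
  solve₄ : ∀ p a g → 6 * p + 4 * a * g ≡ 2 * (2 * a * g + 3 * p)
  solve₄ = solve-∀


-- Strict maxima

exactly atMost : ℕ → ℕ → ℕ
exactly j k = 𝟙 (k ≡ᵇ suc j)
atMost  j k = 𝟙 (k <ᵇ suc j)

levels≡leftSum : ∀ r L Q →
  ∑[ j < L ] (𝔼₁ L (exactly (toℕ j)) * (Q + 𝔼₁ L (atMost (toℕ j))) ^ r) ≡ leftSum r L Q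
levels≡leftSum r zero    Q = refl
levels≡leftSum r (suc L) Q = cong₂ _+_ top (begin-equality
  ∑[ j < L ] (𝔼₁ (suc L) (exactly (suc (toℕ j))) * (Q + 𝔼₁ (suc L) (atMost (suc (toℕ j)))) ^ r)
    ≡⟨ sum-cong-≗ shifted ⟩
  ∑[ j < L ] (𝔼₁ L (exactly (toℕ j)) * (Q + 2 ^ L + 𝔼₁ L (atMost (toℕ j))) ^ r)
    ≡⟨ levels≡leftSum r L (Q + 2 ^ L) ⟩
  leftSum r L (Q + 2 ^ L)
    ∎)
  where
  top : 𝔼₁ (suc L) (exactly 0) * (Q + 𝔼₁ (suc L) (atMost 0)) ^ r ≡ 2 ^ L * Q ^ r
  top = begin-equality
    𝔼₁ (suc L) (exactly 0) * (Q + 𝔼₁ (suc L) (atMost 0)) ^ r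
      ≡⟨ cong₂ (λ a b → a * (Q + b) ^ r) exactly-top atMost-bottom ⟩
    2 ^ L * (Q + 0) ^ r
      ≡⟨ cong (λ q → 2 ^ L * q ^ r) (+-identityʳ Q) ⟩
    2 ^ L * Q ^ r
      ∎
    where
    exactly-top : 𝔼₁ (suc L) (exactly 0) ≡ 2 ^ L
    exactly-top = trans (cong₂ _+_ (*-identityʳ (2 ^ L)) (𝔼₁-vanishing L (λ _ → refl))) (+-identityʳ (2 ^ L))
    atMost-bottom : 𝔼₁ (suc L) (atMost 0) ≡ 0
    atMost-bottom = cong₂ _+_ (*-zeroʳ (2 ^ L)) (𝔼₁-vanishing L (λ _ → refl))
  shifted : ∀ (j : Fin L) → 𝔼₁ (suc L) (exactly (suc (toℕ j))) * (Q + 𝔼₁ (suc L) (atMost (suc (toℕ j)))) ^ r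
                ≡ 𝔼₁ L (exactly (toℕ j)) * (Q + 2 ^ L + 𝔼₁ L (atMost (toℕ j))) ^ r
  shifted j = cong₂ (λ a b → a * b ^ r)
                (cong (_+ 𝔼₁ L (exactly (toℕ j))) (*-zeroʳ (2 ^ L)))
                (trans (cong (λ b → Q + (b + 𝔼₁ L (atMost (toℕ j)))) (*-identityʳ (2 ^ L))) (sym (+-assoc Q _ _)))

levelFactor : ∀ {n} → Fin n → (Fin n → Bool) → ℕ → Fin n → ℕ → ℕ
levelFactor x S j v = if does (v ≟ x) then exactly j else if S v then atMost j else const 1


-- 1 if ℓ x ≤ L and ℓ z < ℓ x for every other z with S z, otherwise 0; summand j is the case ℓ x = j + 1.
strictMax : ∀ {n} → ℕ → Fin n → (Fin n → Bool) → LVals n → ℕ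
strictMax L x S ℓ = ∑[ j < L ] ∏ (λ v → levelFactor x S (toℕ j) v (ℓ v))

module _ {n} (x : Fin n) (S : Fin n → Bool) (j : ℕ) where

  levelFactor-self : levelFactor x S j x ≡ exactly j
  levelFactor-self rewrite dec-true (x ≟ x) refl = refl

  levelFactor-other : ∀ {z} → z ≢ x → T (S z) → levelFactor x S j z ≡ atMost j
  levelFactor-other {z} z≢x Sz rewrite dec-false (z ≟ x) z≢x with true ← S z = refl

  levelFactor-≤1 : ∀ v k → levelFactor x S j v k ≤ 1
  levelFactor-≤1 v k with does (v ≟ x) | S v
  ... | true  | _     = 𝟙≤1 _
  ... | false | true  = 𝟙≤1 _
  ... | false | false = ≤-refl

  𝔼₁-levelFactor : ∀ L v → 𝔼₁ L (levelFactor x S j v)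
                 ≡ (if does (v ≟ x) then 𝔼₁ L (exactly j) else if S v then 𝔼₁ L (atMost j) else total L)
  𝔼₁-levelFactor L v with does (v ≟ x) | S v
  ... | true  | _     = refl
  ... | false | true  = refl
  ... | false | false = refl

module _ {n} (L : ℕ) (x : Fin n) (S : Fin n → Bool) (ℓ : LVals n) where

  private
    level : Fin L → ℕ
    level j = ∏ (λ v → levelFactor x S (toℕ j) v (ℓ v))

    level-value : ∀ j → 0 < level j → ℓ x ≡ suc (toℕ j)
    level-value j pos = ≡ᵇ⇒≡ (ℓ x) (suc (toℕ j))
      (𝟙-positive (subst (λ f → 0 < f (ℓ x)) (levelFactor-self x S (toℕ j)) (∏-positive _ pos x)))

  strictMax-≤1 : strictMax L x S ℓ ≤ 1
  strictMax-≤1 = sum-≤1 level (λ j → ∏-≤1 _ (λ v → levelFactor-≤1 x S (toℕ j) v (ℓ v)))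
    (λ i j posᵢ posⱼ → toℕ-injective (suc-injective (trans (sym (level-value i posᵢ)) (level-value j posⱼ))))

  strictMax-positive : 0 < strictMax L x S ℓ → ∀ {z} → z ≢ x → T (S z) → ℓ z < ℓ x
  strictMax-positive pos {z} z≢x Sz with j , posⱼ ← sum-positive level pos =
    subst (ℓ z <_) (sym (level-value j posⱼ))
      (<ᵇ⇒< (ℓ z) (suc (toℕ j))
        (𝟙-positive (subst (λ f → 0 < f (ℓ z)) (levelFactor-other x S (toℕ j) z≢x Sz) (∏-positive _ posⱼ z))))

wsum-strictMax : ∀ n L (x : Fin n) (S : Fin n → Bool) → T (S x) →
                 wsum n L (strictMax L x S) ≡ leftSum (count (without S x)) L 0 * total L ^ count (not ∘ S)
wsum-strictMax n L x S Sx = begin-equality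
  wsum n L (strictMax L x S)
    ≡⟨ wsum-sum n L (λ (j : Fin L) ℓ → ∏ (λ v → levelFactor x S (toℕ j) v (ℓ v))) ⟩
  ∑[ j < L ] wsum n L (λ ℓ → ∏ (λ v → levelFactor x S (toℕ j) v (ℓ v)))
    ≡⟨ sum-cong-≗ (λ (j : Fin L) → wsum-∏ n L (levelFactor x S (toℕ j))) ⟩
  ∑[ j < L ] ∏ (λ v → 𝔼₁ L (levelFactor x S (toℕ j) v))
    ≡⟨ sum-cong-≗ (λ (j : Fin L) → trans (∏-cong-≗ (𝔼₁-levelFactor x S (toℕ j) L))
                                         (∏-threeValued S x Sx (α j) (β j) (total L))) ⟩
  ∑[ j < L ] (α j * β j ^ r * total L ^ m)
    ≡⟨ *-distribʳ-sum (total L ^ m) (λ j → α j * β j ^ r) ⟨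
  ∑[ j < L ] (α j * β j ^ r) * total L ^ m
    ≡⟨ cong (_* total L ^ m) (levels≡leftSum r L 0) ⟩
  leftSum r L 0 * total L ^ m
    ∎
  where
  r = count (without S x)
  m = count (not ∘ S)
  α β : Fin L → ℕ
  α j = 𝔼₁ L (exactly (toℕ j))
  β j = 𝔼₁ L (atMost (toℕ j))

strictMax-bound : ∀ n L (x : Fin n) (S : Fin n → Bool) a → T (S x) → 3 * count S ≤ 4 * a →
                  4 * total L ^ n ≤ 2 * a * wsum n L (strictMax L x S) + 3 * (2 ^ L) ^ n
strictMax-bound n L x S a Sx 3S≤4a = begin
  4 * t ^ n                                         ≡⟨ cong (λ k → 4 * t ^ k) n≡ ⟨
  4 * t ^ (suc r + m)                               ≡⟨ cong (4 *_) (^-distribˡ-+-* t (suc r) m) ⟩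
  4 * (t ^ suc r * t ^ m)                           ≡⟨ *-assoc 4 (t ^ suc r) (t ^ m) ⟨
  4 * t ^ suc r * t ^ m                             ≤⟨ *-monoˡ-≤ (t ^ m) (leftSum-estimate r L a 3r≤4a) ⟩
  (2 * a * G + 3 * P ^ suc r) * t ^ m               ≡⟨ solve (2 * a) G (t ^ m) (P ^ suc r) ⟩
  2 * a * (G * t ^ m) + 3 * (P ^ suc r * t ^ m)     ≤⟨ +-monoʳ-≤ (2 * a * (G * t ^ m))
                                                         (*-monoʳ-≤ 3 (*-monoʳ-≤ (P ^ suc r) t^m≤P^m)) ⟩
  2 * a * (G * t ^ m) + 3 * (P ^ suc r * P ^ m)     ≡⟨ cong₂ (λ w p → 2 * a * w + 3 * p)
                                                         (wsum-strictMax n L x S Sx) (^-distribˡ-+-* P (suc r) m) ⟨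
  2 * a * wsum n L (strictMax L x S) + 3 * P ^ (suc r + m)
                                                    ≡⟨ cong (λ k → 2 * a * wsum n L (strictMax L x S) + 3 * P ^ k) n≡ ⟩
  2 * a * wsum n L (strictMax L x S) + 3 * P ^ n    ∎
  where
  t = total L
  P = 2 ^ L
  r = count (without S x)
  m = count (not ∘ S)
  G = leftSum r L 0
  t^m≤P^m : t ^ m ≤ P ^ m
  t^m≤P^m = ^-monoˡ-≤ m (total≤2^ L)
  n≡ : suc r + m ≡ n
  n≡ = trans (cong (_+ m) (count-without S x Sx)) (count-complement S)
  3r≤4a : 3 * suc r ≤ 4 * a
  3r≤4a = subst (λ k → 3 * k ≤ 4 * a) (sym (count-without S x Sx)) 3S≤4a
  solve : ∀ b g t q → (b * g + 3 * q) * t ≡ b * (g * t) + 3 * (q * t)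
  solve = solve-∀


-- One round of the protocol

anyFin-intro : ∀ {n} (p : Fin n → Bool) u → T (p u) → T (anyFin n p)
anyFin-intro p u pu = any⁺ p (lose (∈-allFin u) pu)

anyFin-elim : ∀ {n} (p : Fin n → Bool) → T (anyFin n p) → ∃ λ u → T (p u)
anyFin-elim {n} p h = satisfied (any⁻ p (allFin n) h)

anyFin-cong : ∀ {n} {p q : Fin n → Bool} → (∀ u → p u ≡ q u) → anyFin n p ≡ anyFin n q
anyFin-cong {n} p≗q = cong or (map-cong p≗q (allFin n))

isIn⇒≡In : ∀ {s} → T (isIn s) → s ≡ In
isIn⇒≡In {In} _ = refl

isUn⇒≡Un : ∀ {s} → T (isUn s) → s ≡ Un
isUn⇒≡Un {Un} _ = refl

≡In⇒isIn : ∀ {s} → s ≡ In → T (isIn s)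
≡In⇒isIn refl = _

≡Un⇒isUn : ∀ {s} → s ≡ Un → T (isUn s)
≡Un⇒isUn refl = _

module Protocol {n : ℕ} (G : Graph n) where

  Adj : Fin n → Fin n → Set
  Adj u v = T (adj G u v)

  Adj-sym : ∀ {u v} → Adj u v → Adj v u
  Adj-sym {u} {v} = subst T (adj-sym G u v)

  Adj-irrefl : ∀ {v} → ¬ Adj v v
  Adj-irrefl {v} = subst T (irrefl G v)

  hears0-intro : ∀ {c v u} → Adj v u → c u ≡ In → T (hears0 G c v)
  hears0-intro {u = u} a cu = anyFin-intro _ u (from T-∧ (a , ≡In⇒isIn cu))

  hears0-elim : ∀ {c v} → T (hears0 G c v) → ∃ λ u → Adj v u × c u ≡ In
  hears0-elim h with u , au ← anyFin-elim _ h with a , i ← to T-∧ au = u , a , isIn⇒≡In i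

  hearsNote-intro : ∀ {c ℓ v u k} → Adj v u → c u ≡ Un → k ≤ ℓ u → T (hearsNote G c ℓ v k)
  hearsNote-intro {u = u} a cu k≤ℓu =
    anyFin-intro _ u (from T-∧ (a , from T-∧ (≡Un⇒isUn cu , ≤⇒≤ᵇ k≤ℓu)))

  hearsNote-elim : ∀ {c ℓ v k} → T (hearsNote G c ℓ v k) → ∃ λ u → Adj v u × c u ≡ Un × k ≤ ℓ u
  hearsNote-elim {ℓ = ℓ} {k = k} h with u , au ← anyFin-elim _ h with a , rest ← to T-∧ au
    with un , k≤ᵇℓu ← to T-∧ rest = u , a , isUn⇒≡Un un , ≤ᵇ⇒≤ k (ℓ u) k≤ᵇℓu

  module _ {c : Config n} {ℓ : LVals n} {v : Fin n} where

    step-from-In : c v ≡ In → step G c ℓ v ≡ (if hears0 G c v then Un else In)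
    step-from-In cv with c v
    step-from-In refl | In = refl

    step-from-Un : c v ≡ Un → step G c ℓ v ≡ (if hears0 G c v then Out else if hearsNote G c ℓ v (ℓ v) then Un else In)
    step-from-Un cv with c v
    step-from-Un refl | Un = refl

    step-from-Out : c v ≡ Out → step G c ℓ v ≡ (if hears0 G c v then Out else Un)
    step-from-Out cv with c v
    step-from-Out refl | Out = refl

    step-from-silent-Un : c v ≡ Un → ¬ T (hears0 G c v) → step G c ℓ v ≡ (if hearsNote G c ℓ v (ℓ v) then Un else In)
    step-from-silent-Un cv unheard =
      trans (step-from-Un cv) (cong (λ b → if b then Out else if hearsNote G c ℓ v (ℓ v) then Un else In)
                                    (¬T⇒≡false unheard))

    hears0⇒Out : c v ≢ In → T (hears0 G c v) → step G c ℓ v ≡ Out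
    hears0⇒Out cv≢In h = by-state (c v) refl
      where
      by-state : ∀ s → c v ≡ s → step G c ℓ v ≡ Out
      by-state In  cv = contradiction cv cv≢In
      by-state Un  cv = trans (step-from-Un cv)
        (cong (λ b → if b then Out else if hearsNote G c ℓ v (ℓ v) then Un else In) (T⇒≡true h))
      by-state Out cv = trans (step-from-Out cv) (cong (λ b → if b then Out else Un) (T⇒≡true h))

    data JoinsIn : Set where
      stays  : c v ≡ In → ¬ T (hears0 G c v) → JoinsIn
      enters : c v ≡ Un → ¬ T (hears0 G c v) → ¬ T (hearsNote G c ℓ v (ℓ v)) → JoinsIn

    joinsIn : step G c ℓ v ≡ In → JoinsIn
    joinsIn sv = by-state (c v) refl
      where
      by-state : ∀ s → c v ≡ s → JoinsIn
      by-state In  cv = stays cv (case-In _ (trans (sym (step-from-In cv)) sv))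
        where
        case-In : ∀ b → (if b then Un else In) ≡ In → ¬ T b
        case-In true () _
      by-state Un  cv = enters cv (proj₁ cases) (proj₂ cases)
        where
        case-Un : ∀ b b′ → (if b then Out else if b′ then Un else In) ≡ In → ¬ T b × ¬ T b′
        case-Un false false _ = (λ ()) , (λ ())
        cases = case-Un _ _ (trans (sym (step-from-Un cv)) sv)
      by-state Out cv = ⊥-elim (case-Out _ (trans (sym (step-from-Out cv)) sv))
        where
        case-Out : ∀ b → (if b then Out else Un) ≢ In
        case-Out true  ()
        case-Out false ()

  Independent : Config n → Set
  Independent c = ∀ {u v} → Adj u v → c u ≡ In → c v ≢ In

  step-independent : ∀ c ℓ → Independent (step G c ℓ)
  step-independent c ℓ {u} {v} a su sv with joinsIn {c} {ℓ} su | joinsIn {c} {ℓ} sv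
  ... | stays  cu _    | stays  _  h₀v     = h₀v (hears0-intro (Adj-sym a) cu)
  ... | stays  cu _    | enters _  h₀v _   = h₀v (hears0-intro (Adj-sym a) cu)
  ... | enters _  h₀u _ | stays  cv _      = h₀u (hears0-intro a cv)
  ... | enters cu _ hu | enters cv _ hv with ≤-total (ℓ u) (ℓ v)
  ...   | inj₁ ℓu≤ℓv = hu (hearsNote-intro {c} {ℓ} a cv ℓu≤ℓv)
  ...   | inj₂ ℓv≤ℓu = hv (hearsNote-intro {c} {ℓ} (Adj-sym a) cu ℓv≤ℓu)

  reachable-independent : ∀ {c} → Reachable G c → Independent c
  reachable-independent start       a () _
  reachable-independent (next {c} _ ℓ _) = step-independent c ℓ

  covered : Config n → Fin n → Bool
  covered c v = isIn (c v) ∨ hears0 G c v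

  covered-In : ∀ {c v} → c v ≡ In → T (covered c v)
  covered-In cv = from T-∨ (inj₁ (≡In⇒isIn cv))

  covered-hears : ∀ {c v} → T (hears0 G c v) → T (covered c v)
  covered-hears h = from T-∨ (inj₂ h)

  -- Under independence, covered = eliminated, so live c is the set of active edges as ordered pairs.
  live : Config n → Fin n → Fin n → Bool
  live c x y = adj G x y ∧ not (covered c x) ∧ not (covered c y)

  live-intro : ∀ {c x y} → Adj x y → ¬ T (covered c x) → ¬ T (covered c y) → T (live c x y)
  live-intro a ux uy = from T-∧ (a , from T-∧ (¬T⇒T-not ux , ¬T⇒T-not uy))

  live-elim : ∀ {c x y} → T (live c x y) → Adj x y × ¬ T (covered c x) × ¬ T (covered c y)
  live-elim l with a , rest ← to T-∧ l with ux , uy ← to T-∧ rest = a , T-not⇒¬T ux , T-not⇒¬T uy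

  live-sym : ∀ c x y → live c x y ≡ live c y x
  live-sym c x y = cong₂ _∧_ (adj-sym G x y) (∧-comm (not (covered c x)) (not (covered c y)))

  liveEdges : Config n → ℕ
  liveEdges c = ∑[ y < n ] ∑[ x < n ] 𝟙 (live c x y)

  module _ {c : Config n} (ind : Independent c) where

    In⇒¬hears0 : ∀ {v} → c v ≡ In → ¬ T (hears0 G c v)
    In⇒¬hears0 cv h with _ , a , cu ← hears0-elim h = ind (Adj-sym a) cu cv

    inBar≡isIn : ∀ v → inBar G c v ≡ isIn (c v)
    inBar≡isIn v = by-state (c v) refl
      where
      by-state : ∀ s → c v ≡ s → inBar G c v ≡ isIn (c v)
      by-state In  cv rewrite cv | ¬T⇒≡false (In⇒¬hears0 cv) = refl
      by-state Un  cv rewrite cv = refl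
      by-state Out cv rewrite cv = refl

    eliminated≡covered : ∀ v → eliminated G c v ≡ covered c v
    eliminated≡covered v = cong₂ _∨_ (inBar≡isIn v) (anyFin-cong (λ u → cong (adj G v u ∧_) (inBar≡isIn u)))

    In-stays : ∀ {ℓ v} → c v ≡ In → step G c ℓ v ≡ In
    In-stays cv = trans (step-from-In cv) (cong (λ b → if b then Un else In) (¬T⇒≡false (In⇒¬hears0 cv)))

    covered-step : ∀ {ℓ v} → T (covered c v) → T (covered (step G c ℓ) v)
    covered-step {ℓ} cov with to T-∨ cov
    ... | inj₁ i = covered-In (In-stays (isIn⇒≡In i))
    ... | inj₂ h with _ , a , cu ← hears0-elim h = covered-hears (hears0-intro a (In-stays {ℓ} cu))

    uncovered-before : ∀ {ℓ v} → ¬ T (covered (step G c ℓ) v) → ¬ T (covered c v)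
    uncovered-before unc = unc ∘ covered-step

    live-before : ∀ {ℓ x y} → T (live (step G c ℓ) x y) → T (live c x y)
    live-before {ℓ} l with a , ux , uy ← live-elim {step G c ℓ} l = live-intro a (uncovered-before ux) (uncovered-before uy)

    uncovered-step⇒Un : ∀ {ℓ v} → ¬ T (covered (step G c ℓ) v) → step G c ℓ v ≡ Un
    uncovered-step⇒Un {ℓ} {v} unc = by-state (c v) refl
      where
      unheard : ¬ T (hears0 G c v)
      unheard = uncovered-before unc ∘ covered-hears
      by-state : ∀ s → c v ≡ s → step G c ℓ v ≡ Un
      by-state In  cv = contradiction (covered-step (covered-In cv)) unc
      by-state Out cv = trans (step-from-Out cv) (cong (λ b → if b then Out else Un) (¬T⇒≡false unheard))
      by-state Un  cv with hearsNote G c ℓ v (ℓ v) | step-from-silent-Un {ℓ = ℓ} cv unheard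
      ... | true  | sv = sv
      ... | false | sv = contradiction (covered-In sv) unc

    Un-step⇒uncovered : ∀ {ℓ v} → step G c ℓ v ≡ Un → ¬ T (covered c v)
    Un-step⇒uncovered {ℓ} {v} sv cov with to T-∨ cov
    ... | inj₁ i = contradiction (trans (sym sv) (In-stays (isIn⇒≡In i))) λ ()
    ... | inj₂ h = contradiction (trans (sym sv) (hears0⇒Out notIn h)) λ ()
      where
      notIn : c v ≢ In
      notIn cv = contradiction (trans (sym sv) (In-stays cv)) λ ()

    joins-In : ∀ {ℓ x} → c x ≡ Un → ¬ T (covered c x) → (∀ {z} → Adj x z → c z ≡ Un → ℓ z < ℓ x) →
               step G c ℓ x ≡ In
    joins-In {ℓ} {x} cx unc beats =
      trans (step-from-silent-Un cx (unc ∘ covered-hears)) (cong (λ b → if b then Un else In) (¬T⇒≡false unheard))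
      where
      unheard : ¬ T (hearsNote G c ℓ x (ℓ x))
      unheard h with _ , a , cz , ℓx≤ℓz ← hearsNote-elim {c} {ℓ} h = <⇒≱ (beats a cz) ℓx≤ℓz



-- Two rounds

module TwoRounds {n : ℕ} (G : Graph n) {c₀ : Config n} (ind₀ : Protocol.Independent G c₀) (ℓ₁ : LVals n) (L : ℕ)
  where
  open Protocol G

  c₁ : Config n
  c₁ = step G c₀ ℓ₁

  ind₁ : Independent c₁
  ind₁ = step-independent c₀ ℓ₁

  c₂ : LVals n → Config n
  c₂ ℓ₂ = step G c₁ ℓ₂

  deg : Fin n → ℕ
  deg y = ∑[ x < n ] 𝟙 (live c₁ x y)

  -- x joins In in round two if its ℓ-value beats those of all other contenders (x and y are contenders).
  contenders : Fin n → Fin n → Fin n → Bool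
  contenders x y z = isUn (c₁ z) ∧ (adj G x z ∨ adj G y z)

  wins₂ : Fin n → Fin n → LVals n → ℕ
  wins₂ x y = strictMax L x (contenders x y)

  live₁⇒Un : ∀ {x y} → T (live c₁ x y) → c₁ x ≡ Un
  live₁⇒Un l = uncovered-step⇒Un ind₀ (proj₁ (proj₂ (live-elim {c₁} l)))

  neighbour-contends : ∀ {x y z} → T (live c₁ z y) → T (contenders x y z)
  neighbour-contends {x} {y} {z} l =
    from T-∧ (≡Un⇒isUn (live₁⇒Un l) , T-∨ʳ (adj G x z) (Adj-sym (proj₁ (live-elim {c₁} l))))

  winner-covers : ∀ {x y ℓ₂} → T (live c₁ x y) → 0 < wins₂ x y ℓ₂ → T (covered (c₂ ℓ₂) y)
  winner-covers {x} {y} {ℓ₂} l pos with a , ux , _ ← live-elim l =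
    covered-hears (hears0-intro (Adj-sym a) (joins-In ind₁ (live₁⇒Un l) ux beats))
    where
    beats : ∀ {z} → Adj x z → c₁ z ≡ Un → ℓ₂ z < ℓ₂ x
    beats {z} a′ cz = strictMax-positive L x (contenders x y) ℓ₂ pos
      (λ { refl → Adj-irrefl a′ }) (from T-∧ (≡Un⇒isUn cz , from T-∨ (inj₁ a′)))

  winner-unique : ∀ {x x′ y ℓ₂} → T (live c₁ x y) → T (live c₁ x′ y) →
                  0 < wins₂ x y ℓ₂ → 0 < wins₂ x′ y ℓ₂ → x ≡ x′
  winner-unique {x} {x′} {y} {ℓ₂} l l′ pos pos′ with x ≟ x′
  ... | yes x≡x′ = x≡x′
  ... | no  x≢x′ = contradiction
        (strictMax-positive L x (contenders x y) ℓ₂ pos (x≢x′ ∘ sym) (neighbour-contends l′))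
        (<-asym (strictMax-positive L x′ (contenders x′ y) ℓ₂ pos′ x≢x′ (neighbour-contends l)))

  survivors winners : LVals n → Fin n → ℕ
  survivors ℓ₂ y = ∑[ x < n ] 𝟙 (live (c₂ ℓ₂) x y)
  winners   ℓ₂ y = ∑[ x < n ] (𝟙 (live c₁ x y) * wins₂ x y ℓ₂)

  winners-≤1 : ∀ ℓ₂ y → winners ℓ₂ y ≤ 1
  winners-≤1 ℓ₂ y =
    sum-≤1 _ (λ x → *-mono-≤ (𝟙≤1 (live c₁ x y)) (strictMax-≤1 L x (contenders x y) ℓ₂)) unique
    where
    unique : ∀ x x′ → 0 < 𝟙 (live c₁ x y) * wins₂ x y ℓ₂ → 0 < 𝟙 (live c₁ x′ y) * wins₂ x′ y ℓ₂ →
             x ≡ x′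
    unique x x′ pos pos′ = winner-unique {ℓ₂ = ℓ₂}
      (𝟙-positive (*-positiveˡ (𝟙 (live c₁ x y)) pos)) (𝟙-positive (*-positiveˡ (𝟙 (live c₁ x′ y)) pos′))
      (*-positiveʳ (𝟙 (live c₁ x y)) pos) (*-positiveʳ (𝟙 (live c₁ x′ y)) pos′)

  second-round-at : ∀ ℓ₂ y → survivors ℓ₂ y + deg y * winners ℓ₂ y ≤ deg y
  second-round-at ℓ₂ y with T? (covered (c₂ ℓ₂) y)
  ... | yes cov = begin
    survivors ℓ₂ y + deg y * winners ℓ₂ y ≡⟨ cong (_+ deg y * winners ℓ₂ y) (sum-zero dead) ⟩
    deg y * winners ℓ₂ y                  ≤⟨ *-monoʳ-≤ (deg y) (winners-≤1 ℓ₂ y) ⟩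
    deg y * 1                             ≡⟨ *-identityʳ (deg y) ⟩
    deg y                                 ∎
    where
    dead : ∀ x → 𝟙 (live (c₂ ℓ₂) x y) ≡ 0
    dead x = 𝟙-false (λ l → proj₂ (proj₂ (live-elim {c₂ ℓ₂} l)) cov)
  ... | no unc = begin
    survivors ℓ₂ y + deg y * winners ℓ₂ y ≡⟨ cong (λ w → survivors ℓ₂ y + deg y * w) (sum-zero no-winner) ⟩
    survivors ℓ₂ y + deg y * 0            ≡⟨ cong (survivors ℓ₂ y +_) (*-zeroʳ (deg y)) ⟩
    survivors ℓ₂ y + 0                    ≡⟨ +-identityʳ (survivors ℓ₂ y) ⟩
    survivors ℓ₂ y                        ≤⟨ sum-mono-≤ (λ x → 𝟙-mono (live-before ind₁ {ℓ₂} {x} {y})) ⟩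
    deg y                                 ∎
    where
    no-winner : ∀ x → 𝟙 (live c₁ x y) * wins₂ x y ℓ₂ ≡ 0
    no-winner x with T? (live c₁ x y)
    ... | no ¬l = cong (_* wins₂ x y ℓ₂) (𝟙-false ¬l)
    ... | yes l with wins₂ x y ℓ₂ in w
    ...   | zero  = *-zeroʳ (𝟙 (live c₁ x y))
    ...   | suc _ = contradiction (winner-covers l (subst (0 <_) (sym w) z<s)) unc

  winWeight : Fin n → Fin n → ℕ
  winWeight x y = wsum n L (wins₂ x y)

  weightedWins : ℕ
  weightedWins = ∑∑ (λ x y → 𝟙 (live c₁ x y) * (deg y * winWeight x y))

  second-round : wsum n L (liveEdges ∘ c₂) + weightedWins ≤ liveEdges c₁ * total L ^ n
  second-round = begin
    wsum n L (liveEdges ∘ c₂) + weightedWins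
      ≡⟨ cong (wsum n L (liveEdges ∘ c₂) +_) expected-winners ⟨
    wsum n L (liveEdges ∘ c₂) + wsum n L (λ ℓ₂ → ∑[ y < n ] (deg y * winners ℓ₂ y))
      ≡⟨ wsum-+ n L (liveEdges ∘ c₂) _ ⟨
    wsum n L (λ ℓ₂ → liveEdges (c₂ ℓ₂) + ∑[ y < n ] (deg y * winners ℓ₂ y))
      ≡⟨ wsum-cong n L (λ ℓ₂ → ∑-distrib-+ (survivors ℓ₂) (λ y → deg y * winners ℓ₂ y)) ⟨
    wsum n L (λ ℓ₂ → ∑[ y < n ] (survivors ℓ₂ y + deg y * winners ℓ₂ y))
      ≤⟨ wsum-mono-≤ n L (λ ℓ₂ → sum-mono-≤ (second-round-at ℓ₂)) ⟩
    wsum n L (const (liveEdges c₁))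
      ≡⟨ wsum-const n L (liveEdges c₁) ⟩
    liveEdges c₁ * total L ^ n
      ∎
    where
    expected-winners : wsum n L (λ ℓ₂ → ∑[ y < n ] (deg y * winners ℓ₂ y)) ≡ weightedWins
    expected-winners = begin-equality
      wsum n L (λ ℓ₂ → ∑[ y < n ] (deg y * winners ℓ₂ y))
        ≡⟨ wsum-sum n L (λ y ℓ₂ → deg y * winners ℓ₂ y) ⟩
      ∑[ y < n ] wsum n L (λ ℓ₂ → deg y * winners ℓ₂ y)
        ≡⟨ sum-cong-≗ (λ y → wsum-*ˡ n L (deg y) (λ ℓ₂ → winners ℓ₂ y)) ⟩
      ∑[ y < n ] (deg y * wsum n L (λ ℓ₂ → winners ℓ₂ y))
        ≡⟨ sum-cong-≗ (λ y → cong (deg y *_) (begin-equality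
             wsum n L (λ ℓ₂ → winners ℓ₂ y)
               ≡⟨ wsum-sum n L (λ x ℓ₂ → 𝟙 (live c₁ x y) * wins₂ x y ℓ₂) ⟩
             ∑[ x < n ] wsum n L (λ ℓ₂ → 𝟙 (live c₁ x y) * wins₂ x y ℓ₂)
               ≡⟨ sum-cong-≗ (λ x → wsum-*ˡ n L (𝟙 (live c₁ x y)) (wins₂ x y)) ⟩
             ∑[ x < n ] (𝟙 (live c₁ x y) * winWeight x y)
               ∎)) ⟩
      ∑[ y < n ] (deg y * ∑[ x < n ] (𝟙 (live c₁ x y) * winWeight x y))
        ≡⟨ sum-cong-≗ (λ y → trans (sym (sum-*ˡ (deg y) (λ x → 𝟙 (live c₁ x y) * winWeight x y)))
                                   (sum-cong-≗ (λ x → solve (deg y) (𝟙 (live c₁ x y)) (winWeight x y)))) ⟩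
      weightedWins
        ∎
      where
      solve : ∀ d b g → d * (b * g) ≡ b * (d * g)
      solve = solve-∀

  -- Noisy agents were uncovered in c₀ (Un-step⇒uncovered), so edges from them to uncovered agents of c₁
  -- were active in c₀ but are not in c₁; these edges pay for the live edges at heavy endpoints.
  noisy : Fin n → Bool
  noisy z = isUn (c₁ z) ∧ covered c₁ z

  feeds : Fin n → Fin n → Bool
  feeds x y = noisy x ∧ adj G x y ∧ not (covered c₁ y)

  noise : Fin n → ℕ
  noise y = ∑[ x < n ] 𝟙 (feeds x y)

  heavy : Fin n → Bool
  heavy y = deg y <ᵇ 3 * noise y

  contender-counted : ∀ {x z} → c₁ z ≡ Un → Adj x z → ¬ T (covered c₁ x) → T (live c₁ z x ∨ feeds z x)
  contender-counted {x} {z} cz a ux with T? (covered c₁ z)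
  ... | yes cov = from T-∨ (inj₂ (from T-∧
                    (from T-∧ (≡Un⇒isUn cz , cov) , from T-∧ (Adj-sym a , ¬T⇒T-not ux))))
  ... | no  unc = from T-∨ (inj₁ (live-intro (Adj-sym a) unc ux))

  count-contenders : ∀ {x y} → T (live c₁ x y) → count (contenders x y) ≤ (deg x + noise x) + (deg y + noise y)
  count-contenders {x} {y} l with _ , ux , uy ← live-elim {c₁} l = begin
    count (contenders x y)
      ≤⟨ sum-mono-≤ (λ (z : Fin n) → 𝟙-mono (contender-either z)) ⟩
    ∑[ z < n ] 𝟙 ((live c₁ z x ∨ feeds z x) ∨ (live c₁ z y ∨ feeds z y))
      ≤⟨ sum-mono-≤ (λ z → ≤-trans (𝟙-∨ (live c₁ z x ∨ feeds z x) (live c₁ z y ∨ feeds z y))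
                                   (+-mono-≤ (𝟙-∨ (live c₁ z x) (feeds z x)) (𝟙-∨ (live c₁ z y) (feeds z y)))) ⟩
    ∑[ z < n ] ((𝟙 (live c₁ z x) + 𝟙 (feeds z x)) + (𝟙 (live c₁ z y) + 𝟙 (feeds z y)))
      ≡⟨ ∑-distrib-+ (λ z → 𝟙 (live c₁ z x) + 𝟙 (feeds z x)) (λ z → 𝟙 (live c₁ z y) + 𝟙 (feeds z y)) ⟩
    ∑[ z < n ] (𝟙 (live c₁ z x) + 𝟙 (feeds z x)) + ∑[ z < n ] (𝟙 (live c₁ z y) + 𝟙 (feeds z y))
      ≡⟨ cong₂ _+_ (∑-distrib-+ (λ z → 𝟙 (live c₁ z x)) (λ z → 𝟙 (feeds z x)))
                   (∑-distrib-+ (λ z → 𝟙 (live c₁ z y)) (λ z → 𝟙 (feeds z y))) ⟩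
    (deg x + noise x) + (deg y + noise y)
      ∎
    where
    contender-either : ∀ z → T (contenders x y z) → T ((live c₁ z x ∨ feeds z x) ∨ (live c₁ z y ∨ feeds z y))
    contender-either z t with un , near ← to T-∧ t with to T-∨ near
    ... | inj₁ ax = T-∨ˡ (live c₁ z y ∨ feeds z y) (contender-counted (isUn⇒≡Un un) ax ux)
    ... | inj₂ ay = T-∨ʳ (live c₁ z x ∨ feeds z x) (contender-counted (isUn⇒≡Un un) ay uy)

  light : ∀ {y} → ¬ T (heavy y) → 3 * noise y ≤ deg y
  light h = ≮⇒≥ (λ lt → h (<⇒<ᵇ lt))

  light-contenders : ∀ {x y} → T (live c₁ x y) → ¬ T (heavy x) → ¬ T (heavy y) →
                     3 * count (contenders x y) ≤ 4 * (deg x + deg y)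
  light-contenders {x} {y} l hx hy = begin
    3 * count (contenders x y)                             ≤⟨ *-monoʳ-≤ 3 (count-contenders l) ⟩
    3 * ((deg x + noise x) + (deg y + noise y))            ≡⟨ solve (deg x) (noise x) (deg y) (noise y) ⟩
    3 * deg x + 3 * deg y + (3 * noise x + 3 * noise y)    ≤⟨ +-monoʳ-≤ (3 * deg x + 3 * deg y)
                                                                         (+-mono-≤ (light hx) (light hy)) ⟩
    3 * deg x + 3 * deg y + (deg x + deg y)                ≡⟨ solve′ (deg x) (deg y) ⟩
    4 * (deg x + deg y)                                    ∎
    where
    solve : ∀ a b c d → 3 * ((a + b) + (c + d)) ≡ 3 * a + 3 * c + (3 * b + 3 * d)
    solve = solve-∀
    solve′ : ∀ a c → 3 * a + 3 * c + (a + c) ≡ 4 * (a + c)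
    solve′ = solve-∀

  pair-bound : ∀ {x y} → T (live c₁ x y) →
               4 * total L ^ n
                 ≤ 2 * (deg x + deg y) * winWeight x y + 3 * (2 ^ L) ^ n + (2 ^ L) ^ n * 𝟙 (heavy x ∨ heavy y)
  pair-bound {x} {y} l with T? (heavy x ∨ heavy y)
  ... | yes h = begin
    4 * total L ^ n                         ≤⟨ *-monoʳ-≤ 4 (^-monoˡ-≤ n (total≤2^ L)) ⟩
    4 * P                                   ≡⟨ solve P ⟩
    3 * P + P * 1                           ≤⟨ m≤n+m (3 * P + P * 1) (2 * (deg x + deg y) * winWeight x y) ⟩
    2 * (deg x + deg y) * winWeight x y + (3 * P + P * 1)
                                            ≡⟨ +-assoc (2 * (deg x + deg y) * winWeight x y) (3 * P) (P * 1) ⟨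
    2 * (deg x + deg y) * winWeight x y + 3 * P + P * 1
                                            ≡⟨ cong (λ b → 2 * (deg x + deg y) * winWeight x y + 3 * P + P * 𝟙 b)
                                                    (T⇒≡true h) ⟨
    2 * (deg x + deg y) * winWeight x y + 3 * P + P * 𝟙 (heavy x ∨ heavy y)
                                            ∎
    where
    P = (2 ^ L) ^ n
    solve : ∀ p → 4 * p ≡ 3 * p + p * 1
    solve = solve-∀
  ... | no h = ≤-trans
    (strictMax-bound n L x (contenders x y) (deg x + deg y) (neighbour-contends l)
      (light-contenders l (h ∘ T-∨ˡ (heavy y)) (h ∘ T-∨ʳ (heavy x))))
    (m≤m+n _ _)

  winWeight-sym : ∀ {x y} → T (live c₁ x y) → winWeight x y ≡ winWeight y x
  winWeight-sym {x} {y} l = begin-equality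
    winWeight x y
      ≡⟨ wsum-strictMax n L x (contenders x y) (neighbour-contends l) ⟩
    leftSum (count (without (contenders x y) x)) L 0 * total L ^ count (not ∘ contenders x y)
      ≡⟨ cong₂ (λ r m → leftSum r L 0 * total L ^ m) same-r (sum-cong-≗ (λ z → cong (𝟙 ∘ not) (swap z))) ⟩
    leftSum (count (without (contenders y x) y)) L 0 * total L ^ count (not ∘ contenders y x)
      ≡⟨ wsum-strictMax n L y (contenders y x) (neighbour-contends l′) ⟨
    winWeight y x
      ∎
    where
    l′ = subst T (live-sym c₁ x y) l
    swap : ∀ z → contenders x y z ≡ contenders y x z
    swap z = cong (isUn (c₁ z) ∧_) (∨-comm (adj G x z) (adj G y z))
    same-r : count (without (contenders x y) x) ≡ count (without (contenders y x) y)
    same-r = suc-injective (begin-equality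
      suc (count (without (contenders x y) x)) ≡⟨ count-without (contenders x y) x (neighbour-contends l) ⟩
      count (contenders x y)                   ≡⟨ sum-cong-≗ (λ z → cong 𝟙 (swap z)) ⟩
      count (contenders y x)                   ≡⟨ count-without (contenders y x) y (neighbour-contends l′) ⟨
      suc (count (without (contenders y x) y)) ∎)

  live-weight-sym : ∀ (w : Fin n → ℕ) x y →
                    𝟙 (live c₁ y x) * (w y * winWeight y x) ≡ 𝟙 (live c₁ x y) * (w y * winWeight x y)
  live-weight-sym w x y with T? (live c₁ x y)
  ... | yes l rewrite live-sym c₁ y x | T⇒≡true l | winWeight-sym l = refl
  ... | no ¬l rewrite live-sym c₁ y x | ¬T⇒≡false ¬l = refl

  symmetrized : ∑∑ (λ x y → 𝟙 (live c₁ x y) * (deg x * winWeight x y)) ≡ weightedWins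
  symmetrized = trans (∑∑-transpose (λ x y → 𝟙 (live c₁ x y) * (deg x * winWeight x y)))
                      (∑∑-cong (live-weight-sym deg))

  heavyEdges : ℕ
  heavyEdges = ∑∑ (λ x y → 𝟙 (live c₁ x y) * 𝟙 (heavy x ∨ heavy y))

  pairs-bound : 4 * total L ^ n * liveEdges c₁
                ≤ 4 * weightedWins + 3 * (2 ^ L) ^ n * liveEdges c₁ + (2 ^ L) ^ n * heavyEdges
  pairs-bound = begin
    4 * total L ^ n * liveEdges c₁
      ≡⟨ ∑∑-*ˡ (4 * total L ^ n) (λ x y → 𝟙 (live c₁ x y)) ⟨
    ∑∑ (λ x y → 4 * total L ^ n * 𝟙 (live c₁ x y))
      ≡⟨ ∑∑-cong (λ x y → *-comm (4 * total L ^ n) (𝟙 (live c₁ x y))) ⟩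
    ∑∑ (λ x y → 𝟙 (live c₁ x y) * (4 * total L ^ n))
      ≤⟨ ∑∑-mono-≤ (λ x y → 𝟙-*-mono-≤ (live c₁ x y) pair-bound) ⟩
    ∑∑ (λ x y → 𝟙 (live c₁ x y) * (2 * (deg x + deg y) * winWeight x y + 3 * P + P * 𝟙 (heavy x ∨ heavy y)))
      ≡⟨ ∑∑-cong (λ x y → solve (𝟙 (live c₁ x y)) (deg x) (deg y) (winWeight x y) P (𝟙 (heavy x ∨ heavy y))) ⟩
    ∑∑ (λ x y → 2 * X x y + 2 * Y x y + 3 * P * E x y + P * H x y)
      ≡⟨ split ⟩
    2 * ∑∑ X + 2 * ∑∑ Y + 3 * P * liveEdges c₁ + P * heavyEdges
      ≡⟨ cong (λ a → 2 * a + 2 * weightedWins + 3 * P * liveEdges c₁ + P * heavyEdges) symmetrized ⟩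
    2 * weightedWins + 2 * weightedWins + 3 * P * liveEdges c₁ + P * heavyEdges
      ≡⟨ cong (λ a → a + 3 * P * liveEdges c₁ + P * heavyEdges) (solve′ weightedWins) ⟩
    4 * weightedWins + 3 * P * liveEdges c₁ + P * heavyEdges
      ∎
    where
    P = (2 ^ L) ^ n
    E X Y H : Fin n → Fin n → ℕ
    E x y = 𝟙 (live c₁ x y)
    X x y = E x y * (deg x * winWeight x y)
    Y x y = E x y * (deg y * winWeight x y)
    H x y = E x y * 𝟙 (heavy x ∨ heavy y)
    solve : ∀ e a b g p h → e * (2 * (a + b) * g + 3 * p + p * h)
                          ≡ 2 * (e * (a * g)) + 2 * (e * (b * g)) + 3 * p * e + p * (e * h)
    solve = solve-∀
    solve′ : ∀ w → 2 * w + 2 * w ≡ 4 * w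
    solve′ = solve-∀
    split : ∑∑ (λ x y → 2 * X x y + 2 * Y x y + 3 * P * E x y + P * H x y)
          ≡ 2 * ∑∑ X + 2 * ∑∑ Y + 3 * P * liveEdges c₁ + P * heavyEdges
    split = begin-equality
      ∑∑ (λ x y → 2 * X x y + 2 * Y x y + 3 * P * E x y + P * H x y)
        ≡⟨ ∑∑-+ (λ x y → 2 * X x y + 2 * Y x y + 3 * P * E x y) (λ x y → P * H x y) ⟩
      ∑∑ (λ x y → 2 * X x y + 2 * Y x y + 3 * P * E x y) + ∑∑ (λ x y → P * H x y)
        ≡⟨ cong₂ _+_ (∑∑-+ (λ x y → 2 * X x y + 2 * Y x y) (λ x y → 3 * P * E x y)) (∑∑-*ˡ P H) ⟩
      ∑∑ (λ x y → 2 * X x y + 2 * Y x y) + ∑∑ (λ x y → 3 * P * E x y) + P * heavyEdges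
        ≡⟨ cong₂ (λ a b → a + b + P * heavyEdges)
                 (∑∑-+ (λ x y → 2 * X x y) (λ x y → 2 * Y x y)) (∑∑-*ˡ (3 * P) E) ⟩
      ∑∑ (λ x y → 2 * X x y) + ∑∑ (λ x y → 2 * Y x y) + 3 * P * liveEdges c₁ + P * heavyEdges
        ≡⟨ cong₂ (λ a b → a + b + 3 * P * liveEdges c₁ + P * heavyEdges) (∑∑-*ˡ 2 X) (∑∑-*ˡ 2 Y) ⟩
      2 * ∑∑ X + 2 * ∑∑ Y + 3 * P * liveEdges c₁ + P * heavyEdges
        ∎

  noiseEdges : ℕ
  noiseEdges = ∑∑ (λ x y → 𝟙 (feeds x y))

  heavy-deg : ∀ y → deg y * 𝟙 (heavy y) ≤ 3 * noise y
  heavy-deg y with T? (heavy y)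
  ... | yes h rewrite T⇒≡true h =
    ≤-trans (≤-reflexive (*-identityʳ (deg y))) (<⇒≤ (<ᵇ⇒< (deg y) (3 * noise y) h))
  ... | no ¬h rewrite ¬T⇒≡false ¬h = ≤-trans (≤-reflexive (*-zeroʳ (deg y))) z≤n

  heavy-bound : heavyEdges ≤ 6 * noiseEdges
  heavy-bound = begin
    heavyEdges
      ≤⟨ ∑∑-mono-≤ (λ x y → ≤-trans (*-monoʳ-≤ (𝟙 (live c₁ x y)) (𝟙-∨ (heavy x) (heavy y)))
                                     (≤-reflexive (*-distribˡ-+ (𝟙 (live c₁ x y)) (𝟙 (heavy x)) (𝟙 (heavy y))))) ⟩
    ∑∑ (λ x y → 𝟙 (live c₁ x y) * 𝟙 (heavy x) + 𝟙 (live c₁ x y) * 𝟙 (heavy y))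
      ≡⟨ ∑∑-+ (λ x y → 𝟙 (live c₁ x y) * 𝟙 (heavy x)) (λ x y → 𝟙 (live c₁ x y) * 𝟙 (heavy y)) ⟩
    ∑∑ (λ x y → 𝟙 (live c₁ x y) * 𝟙 (heavy x)) + heavyAt
      ≡⟨ cong (_+ heavyAt) (trans (∑∑-transpose (λ x y → 𝟙 (live c₁ x y) * 𝟙 (heavy x)))
                                  (∑∑-cong (λ x y → cong (λ b → 𝟙 b * 𝟙 (heavy y)) (live-sym c₁ y x)))) ⟩
    heavyAt + heavyAt
      ≤⟨ +-mono-≤ heavyAt≤ heavyAt≤ ⟩
    3 * noiseEdges + 3 * noiseEdges
      ≡⟨ solve noiseEdges ⟩
    6 * noiseEdges
      ∎
    where
    heavyAt : ℕ
    heavyAt = ∑∑ (λ x y → 𝟙 (live c₁ x y) * 𝟙 (heavy y))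
    heavyAt≤ : heavyAt ≤ 3 * noiseEdges
    heavyAt≤ = begin
      heavyAt
        ≡⟨ sum-cong-≗ (λ y → *-distribʳ-sum (𝟙 (heavy y)) (λ x → 𝟙 (live c₁ x y))) ⟨
      ∑[ y < n ] (deg y * 𝟙 (heavy y))
        ≤⟨ sum-mono-≤ heavy-deg ⟩
      ∑[ y < n ] (3 * noise y)
        ≡⟨ sum-*ˡ 3 noise ⟩
      3 * noiseEdges
        ∎
    solve : ∀ m → 3 * m + 3 * m ≡ 6 * m
    solve = solve-∀

  feeds-elim : ∀ {x y} → T (feeds x y) → c₁ x ≡ Un × T (covered c₁ x) × Adj x y × ¬ T (covered c₁ y)
  feeds-elim f with nx , rest ← to T-∧ f with un , cov ← to T-∧ nx with a , uy ← to T-∧ rest =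
    isUn⇒≡Un un , cov , a , T-not⇒¬T uy

  feeds-covered : ∀ {x y} → T (feeds x y) → T (covered c₁ x)
  feeds-covered = proj₁ ∘ proj₂ ∘ feeds-elim

  feeds-uncovered : ∀ {x y} → T (feeds x y) → ¬ T (covered c₁ y)
  feeds-uncovered = proj₂ ∘ proj₂ ∘ proj₂ ∘ feeds-elim

  feeds⇒live₀ : ∀ {x y} → T (feeds x y) → T (live c₀ x y)
  feeds⇒live₀ f with cx , _ , a , uy ← feeds-elim f =
    live-intro a (Un-step⇒uncovered ind₀ cx) (uncovered-before ind₀ uy)

  noise-bound : liveEdges c₁ + 2 * noiseEdges ≤ liveEdges c₀
  noise-bound = begin
    liveEdges c₁ + 2 * noiseEdges
      ≡⟨ solve (liveEdges c₁) noiseEdges ⟩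
    liveEdges c₁ + noiseEdges + noiseEdges
      ≡⟨ cong (liveEdges c₁ + noiseEdges +_) (∑∑-transpose (λ x y → 𝟙 (feeds x y))) ⟩
    liveEdges c₁ + noiseEdges + ∑∑ (λ x y → 𝟙 (feeds y x))
      ≡⟨ cong (_+ ∑∑ (λ x y → 𝟙 (feeds y x)))
              (∑∑-+ (λ x y → 𝟙 (live c₁ x y)) (λ x y → 𝟙 (feeds x y))) ⟨
    ∑∑ (λ x y → 𝟙 (live c₁ x y) + 𝟙 (feeds x y)) + ∑∑ (λ x y → 𝟙 (feeds y x))
      ≡⟨ ∑∑-+ (λ x y → 𝟙 (live c₁ x y) + 𝟙 (feeds x y)) (λ x y → 𝟙 (feeds y x)) ⟨
    ∑∑ (λ x y → 𝟙 (live c₁ x y) + 𝟙 (feeds x y) + 𝟙 (feeds y x))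
      ≤⟨ ∑∑-mono-≤ classes ⟩
    liveEdges c₀
      ∎
    where
    classes : ∀ x y → 𝟙 (live c₁ x y) + 𝟙 (feeds x y) + 𝟙 (feeds y x) ≤ 𝟙 (live c₀ x y)
    classes x y = 𝟙-exclusive (live-before ind₀ {ℓ₁}) feeds⇒live₀ (subst T (live-sym c₀ y x) ∘ feeds⇒live₀)
      (λ l f → proj₁ (proj₂ (live-elim {c₁} l)) (feeds-covered f))
      (λ l f → proj₂ (proj₂ (live-elim {c₁} l)) (feeds-covered f))
      (λ f f′ → feeds-uncovered f (feeds-covered f′))
    solve : ∀ e m → e + 2 * m ≡ e + m + m
    solve = solve-∀

  two-rounds : 4 * wsum n L (liveEdges ∘ c₂) ≤ 3 * (2 ^ L) ^ n * liveEdges c₀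
  two-rounds = +-cancelʳ-≤ (4 * weightedWins) _ _ (begin
    4 * wsum n L (liveEdges ∘ c₂) + 4 * weightedWins
      ≡⟨ *-distribˡ-+ 4 (wsum n L (liveEdges ∘ c₂)) weightedWins ⟨
    4 * (wsum n L (liveEdges ∘ c₂) + weightedWins)
      ≤⟨ *-monoʳ-≤ 4 second-round ⟩
    4 * (liveEdges c₁ * total L ^ n)
      ≡⟨ solve₁ (liveEdges c₁) (total L ^ n) ⟩
    4 * total L ^ n * liveEdges c₁
      ≤⟨ pairs-bound ⟩
    4 * weightedWins + 3 * P * liveEdges c₁ + P * heavyEdges
      ≤⟨ +-monoʳ-≤ (4 * weightedWins + 3 * P * liveEdges c₁) (*-monoʳ-≤ P heavy-bound) ⟩
    4 * weightedWins + 3 * P * liveEdges c₁ + P * (6 * noiseEdges)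
      ≡⟨ solve₂ weightedWins P (liveEdges c₁) noiseEdges ⟩
    3 * P * (liveEdges c₁ + 2 * noiseEdges) + 4 * weightedWins
      ≤⟨ +-monoˡ-≤ (4 * weightedWins) (*-monoʳ-≤ (3 * P) noise-bound) ⟩
    3 * P * liveEdges c₀ + 4 * weightedWins
      ∎)
    where
    P = (2 ^ L) ^ n
    solve₁ : ∀ d t → 4 * (d * t) ≡ 4 * t * d
    solve₁ = solve-∀
    solve₂ : ∀ w p d m → 4 * w + 3 * p * d + p * (6 * m) ≡ 3 * p * (d + 2 * m) + 4 * w
    solve₂ = solve-∀


-- Counting active edges

sumList-tabulate : ∀ {n} (f : Fin n → ℕ) → sumList (tabulate f) ≡ sum f
sumList-tabulate {zero}  f = refl
sumList-tabulate {suc n} f = cong (f fz +_) (sumList-tabulate (f ∘ fs))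

sumList-allFin : ∀ {n} (f : Fin n → ℕ) → sumList (map f (allFin n)) ≡ sum f
sumList-allFin {n} f = trans (cong sumList (map-tabulate (λ v → v) f)) (sumList-tabulate f)

length-filter : ∀ {A : Set} (p : A → Bool) xs → length (filter (λ v → T? (p v)) xs) ≡ sumList (map (𝟙 ∘ p) xs)
length-filter p []       = refl
length-filter p (x ∷ xs) with p x
... | true  = cong suc (length-filter p xs)
... | false = length-filter p xs

ordered-split : ∀ {n} (x y : Fin n) b → (x ≡ y → b ≡ false) →
                𝟙 b ≡ 𝟙 ((toℕ x <ᵇ toℕ y) ∧ b) + 𝟙 ((toℕ y <ᵇ toℕ x) ∧ b)
ordered-split x y b diag with <-cmp (toℕ x) (toℕ y)
... | tri< x<y _ y≮x rewrite T⇒≡true (<⇒<ᵇ x<y) | ¬T⇒≡false (y≮x ∘ <ᵇ⇒< (toℕ y) (toℕ x)) =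
  sym (+-identityʳ (𝟙 b))
... | tri> x≮y _ y<x rewrite T⇒≡true (<⇒<ᵇ y<x) | ¬T⇒≡false (x≮y ∘ <ᵇ⇒< (toℕ x) (toℕ y)) = refl
... | tri≈ _ x≡y _ rewrite diag (toℕ-injective x≡y) | ∧-zeroʳ (toℕ x <ᵇ toℕ y) | ∧-zeroʳ (toℕ y <ᵇ toℕ x) =
  refl

module _ {n : ℕ} (G : Graph n) where
  open Protocol G

  twice-activeEdges : ∀ {c} → Independent c → 2 * activeEdges G c ≡ liveEdges c
  twice-activeEdges {c} ind = begin-equality
    2 * activeEdges G c                ≡⟨ cong (2 *_) active≡ordered ⟩
    2 * ordered                        ≡⟨ solve ordered ⟩
    ordered + ordered                  ≡⟨ cong₂ _+_ (∑∑-transpose lower) upper≡ordered ⟨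
    ∑∑ lower + ∑∑ upper                ≡⟨ ∑∑-+ lower upper ⟨
    ∑∑ (λ x y → lower x y + upper x y) ≡⟨ ∑∑-cong (λ x y → ordered-split x y (live c x y) diag) ⟨
    liveEdges c                        ∎
    where
    lower upper : Fin n → Fin n → ℕ
    lower x y = 𝟙 ((toℕ x <ᵇ toℕ y) ∧ live c x y)
    upper x y = 𝟙 ((toℕ y <ᵇ toℕ x) ∧ live c x y)
    ordered : ℕ
    ordered = ∑∑ (λ x y → lower y x)
    upper≡ordered : ∑∑ upper ≡ ordered
    upper≡ordered = ∑∑-cong (λ x y → cong (λ b → 𝟙 ((toℕ y <ᵇ toℕ x) ∧ b)) (live-sym c x y))
    diag : ∀ {x y} → x ≡ y → live c x y ≡ false
    diag {x} refl = ¬T⇒≡false (Adj-irrefl ∘ proj₁ ∘ live-elim {c})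
    active≡live : ∀ u v → (adj G u v ∧ active G c u ∧ active G c v) ≡ live c u v
    active≡live u v =
      cong (adj G u v ∧_) (cong₂ (λ a b → not a ∧ not b) (eliminated≡covered ind u) (eliminated≡covered ind v))
    active≡ordered : activeEdges G c ≡ ordered
    active≡ordered = trans (sumList-allFin edgesFrom) (sum-cong-≗ (λ (u : Fin n) → begin-equality
      edgesFrom u
        ≡⟨ length-filter (activeAbove u) (allFin n) ⟩
      sumList (map (𝟙 ∘ activeAbove u) (allFin n))
        ≡⟨ sumList-allFin (𝟙 ∘ activeAbove u) ⟩
      ∑[ v < n ] 𝟙 (activeAbove u v)
        ≡⟨ sum-cong-≗ (λ v → cong (λ b → 𝟙 ((toℕ u <ᵇ toℕ v) ∧ b)) (active≡live u v)) ⟩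
      ∑[ v < n ] 𝟙 ((toℕ u <ᵇ toℕ v) ∧ live c u v)
        ∎))
      where
      activeAbove : Fin n → Fin n → Bool
      activeAbove u v = (toℕ u <ᵇ toℕ v) ∧ adj G u v ∧ active G c u ∧ active G c v
      edgesFrom : Fin n → ℕ
      edgesFrom u = length (filter (λ v → T? (activeAbove u v)) (allFin n))
    solve : ∀ m → 2 * m ≡ m + m
    solve = solve-∀

two-rounds-activeEdges : ∀ {n} (G : Graph n) {c : Config n} → Protocol.Independent G c → (L : ℕ) (ℓ₁ : LVals n) →
  4 * wsum n L (λ ℓ₂ → activeEdges G (step G (step G c ℓ₁) ℓ₂)) ≤ 3 * activeEdges G c * (2 ^ L) ^ n
two-rounds-activeEdges {n} G {c} ind L ℓ₁ = *-cancelˡ-≤ 2 (begin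
  2 * (4 * wsum n L E₂)                       ≡⟨ solve₁ (wsum n L E₂) ⟩
  4 * (2 * wsum n L E₂)                       ≡⟨ cong (4 *_) (wsum-*ˡ n L 2 E₂) ⟨
  4 * wsum n L (λ ℓ₂ → 2 * E₂ ℓ₂)             ≡⟨ cong (4 *_) (wsum-cong n L twice-E₂) ⟩
  4 * wsum n L (λ ℓ₂ → liveEdges (c₂ ℓ₂))     ≤⟨ two-rounds ⟩
  3 * P * liveEdges c                          ≡⟨ cong (3 * P *_) (twice-activeEdges G ind) ⟨
  3 * P * (2 * activeEdges G c)                ≡⟨ solve₂ P (activeEdges G c) ⟩
  2 * (3 * activeEdges G c * P)                ∎)
  where
  open Protocol G
  open TwoRounds G ind ℓ₁ L using (c₁; c₂; two-rounds)
  P = (2 ^ L) ^ n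
  E₂ : LVals n → ℕ
  E₂ ℓ₂ = activeEdges G (c₂ ℓ₂)
  twice-E₂ : ∀ ℓ₂ → 2 * E₂ ℓ₂ ≡ liveEdges (c₂ ℓ₂)
  twice-E₂ ℓ₂ = twice-activeEdges G (step-independent c₁ ℓ₂)
  solve₁ : ∀ w → 2 * (4 * w) ≡ 4 * (2 * w)
  solve₁ = solve-∀
  solve₂ : ∀ p a → 3 * p * (2 * a) ≡ 2 * (3 * a * p)
  solve₂ = solve-∀

lemma1 : ∀ {n} (G : Graph n) (c : Config n) → Reachable G c → (L : ℕ) →
         4 * wsum n L (λ ℓ₁ → wsum n L (λ ℓ₂ → activeEdges G (step G (step G c ℓ₁) ℓ₂)))
           ≤ 3 * activeEdges G c * (2 ^ (n * L) * 2 ^ (n * L))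
lemma1 {n} G c reachable L = begin
  4 * wsum n L E                        ≡⟨ wsum-*ˡ n L 4 E ⟨
  wsum n L (λ ℓ₁ → 4 * E ℓ₁)            ≤⟨ wsum-mono-≤ n L (two-rounds-activeEdges G independent L) ⟩
  wsum n L (const (K * P))              ≡⟨ wsum-const n L (K * P) ⟩
  K * P * total L ^ n                   ≤⟨ *-monoʳ-≤ (K * P) (^-monoˡ-≤ n (total≤2^ L)) ⟩
  K * P * P                             ≡⟨ *-assoc K P P ⟩
  K * (P * P)                           ≡⟨ cong (λ p → K * (p * p)) P≡ ⟩
  K * (2 ^ (n * L) * 2 ^ (n * L))       ∎
  where
  independent = Protocol.reachable-independent G reachable
  E : LVals n → ℕ
  E ℓ₁ = wsum n L (λ ℓ₂ → activeEdges G (step G (step G c ℓ₁) ℓ₂))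
  K = 3 * activeEdges G c
  P = (2 ^ L) ^ n
  P≡ : P ≡ 2 ^ (n * L)
  P≡ = trans (^-*-assoc 2 L n) (cong (2 ^_) (*-comm L n))
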